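{- Let $\varphi(x)=x^2-2$. For $t_0\in\mathbb Z$ with $t_0\equiv0$ or $1\pmod 4$, the polynomial $\varphi^{\circ n}(x)-t_0$ is irreducible over $\mathbb Q$ for every $n\ge1$.
   Context: $\varphi^{\circ n}$ denotes the $n$-fold iterate of $\varphi$. -}

module Defs where

open import Data.Nat using (ℕ; zero; suc)
open import Data.Integer as ℤ using (ℤ; +_)
open import Data.Rational as ℚ using (ℚ; 0ℚ; _/_)
open import Data.List using (List; []; _∷_; map; foldr)
open import Data.Product using (Σ; ∃; _×_)
open import Data.Sum using (_⊎_)
open import Relation.Nullary using (¬_)
open import Relation.Binary.PropositionalEquality using (_≡_; _≢_)

-- Polynomials over ℚ as coefficient lists, lowest degree first.
-- Trailing zeros are allowed; equality is coefficientwise (≈ₚ).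
Poly : Set
Poly = List ℚ

coeff : Poly → ℕ → ℚ
coeff []      _       = 0ℚ
coeff (a ∷ p) zero    = a
coeff (a ∷ p) (suc i) = coeff p i

infix 4 _≈ₚ_
_≈ₚ_ : Poly → Poly → Set
p ≈ₚ q = ∀ i → coeff p i ≡ coeff q i

const : ℚ → Poly
const c = c ∷ []

X : Poly
X = 0ℚ ∷ ℚ.1ℚ ∷ []

infixl 6 _+ₚ_
_+ₚ_ : Poly → Poly → Poly
[]      +ₚ q       = q
(a ∷ p) +ₚ []      = a ∷ p
(a ∷ p) +ₚ (b ∷ q) = (a ℚ.+ b) ∷ (p +ₚ q)

scale : ℚ → Poly → Poly
scale c p = map (c ℚ.*_) p

infixl 7 _*ₚ_
_*ₚ_ : Poly → Poly → Poly
[]      *ₚ q = []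
(a ∷ p) *ₚ q = scale a q +ₚ (0ℚ ∷ (p *ₚ q))

_∘ₚ_ : Poly → Poly → Poly
p ∘ₚ g = foldr (λ a acc → const a +ₚ g *ₚ acc) [] p

φ : Poly
φ = ℚ.- (+ 2 / 1) ∷ 0ℚ ∷ ℚ.1ℚ ∷ []

φ^∘ : ℕ → Poly
φ^∘ zero    = X
φ^∘ (suc n) = φ ∘ₚ φ^∘ n

ℤ→ℚ : ℤ → ℚ
ℤ→ℚ t = t / 1

IsUnit : Poly → Set
IsUnit p = Σ ℚ λ c → c ≢ 0ℚ × p ≈ₚ const c

Irreducible : Poly → Set
Irreducible f =
  ¬ (f ≈ₚ []) × ¬ IsUnit f ×
  (∀ g h → f ≈ₚ g *ₚ h → IsUnit g ⊎ IsUnit h)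

module Submission where

-- Let c = 0 or 1 according as t₀ ≡ 0 or 1 (mod 4) and P = φ^∘n(x + c). Since φ(y) ≡ y² (mod 2),
-- P ≡ x^(2ⁿ) + φ^∘n(c) (mod 2), P is monic of degree 2ⁿ, and φ^∘n(c) − t₀ ≡ 2 (mod 4): the orbit of 0
-- is ≡ 2 (mod 4) from the first step on and the orbit of 1 is constantly −1. So P − t₀ is Eisenstein
-- at 2. Eisenstein's argument, run after splitting off the powers of 2 in the contents of the factors,
-- excludes every factorisation G H = m (φ^∘n − t₀) into nonconstant integer polynomials with m ≠ 0,
-- and clearing denominators turns a factorisation over ℚ into such a one (Gauss's lemma).

open import Level using (Level)
open import Algebra.Core using (Op₂)
open import Algebra.Structures using (IsCommutativeSemiring; IsCommutativeRing)
open import Algebra.Bundles using (CommutativeSemigroup; CommutativeMonoid)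
import Algebra.Properties.CommutativeSemigroup as CommutativeSemigroupProperties
open import Data.Nat as ℕ using (ℕ; zero; suc; _<_; _≤_; s≤s; z≤n)
import Data.Nat.Properties as ℕ
import Data.Nat.Divisibility as ℕ
open import Data.List using (List; []; _∷_; map; foldr)
open import Data.Product using (Σ; ∃; _,_; _×_; proj₁; proj₂)
open import Data.Sum as Sum using (_⊎_; inj₁; inj₂; [_,_]′)
open import Data.Empty using (⊥-elim)
open import Function using (case_of_; _∘′_)
open import Relation.Nullary using (¬_; yes; no)
open import Relation.Binary.Bundles using (Setoid)
open import Relation.Binary.Definitions using (tri<; tri≈; tri>)
open import Relation.Binary.PropositionalEquality
import Relation.Binary.Reasoning.Setoid as SetoidReasoning

module Polynomial {c : Level} {A : Set c} {add mul : Op₂ A} {0# 1# : A}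
  (isCommutativeSemiring : IsCommutativeSemiring _≡_ add mul 0# 1#) where

  open IsCommutativeSemiring isCommutativeSemiring
    using ( +-assoc; +-comm; +-identityˡ; +-identityʳ; *-assoc; *-comm; *-identityˡ
          ; distribˡ; distribʳ; zeroˡ; zeroʳ; +-isCommutativeSemigroup)

  private
    +-commutativeSemigroup : CommutativeSemigroup c c
    +-commutativeSemigroup = record { isCommutativeSemigroup = +-isCommutativeSemigroup }

    module +-Props = CommutativeSemigroupProperties +-commutativeSemigroup

  infixl 6 _+_ _⊕_
  infixl 7 _*_ _⊗_
  infix 4 _≈_
  infix 8 _∘_

  _+_ _*_ : Op₂ A
  _+_ = add
  _*_ = mul

  conv : (ℕ → A) → (ℕ → A) → ℕ → A
  conv a b zero    = a 0 * b 0
  conv a b (suc k) = a 0 * b (suc k) + conv (λ i → a (suc i)) b k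

  conv-cong : ∀ {a a′ b b′} → (∀ i → a i ≡ a′ i) → (∀ i → b i ≡ b′ i) →
              ∀ k → conv a b k ≡ conv a′ b′ k
  conv-cong ea eb zero    = cong₂ _*_ (ea 0) (eb 0)
  conv-cong ea eb (suc k) = cong₂ _+_ (cong₂ _*_ (ea 0) (eb (suc k))) (conv-cong (λ i → ea (suc i)) eb k)

  conv-zeroˡ : ∀ {a} b → (∀ i → a i ≡ 0#) → ∀ k → conv a b k ≡ 0#
  conv-zeroˡ b a≡0 zero    = trans (cong (_* b 0) (a≡0 0)) (zeroˡ _)
  conv-zeroˡ b a≡0 (suc k) =
    trans (cong₂ _+_ (trans (cong (_* b (suc k)) (a≡0 0)) (zeroˡ _)) (conv-zeroˡ b (λ i → a≡0 (suc i)) k))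
          (+-identityˡ 0#)

  conv-+ˡ : ∀ a a′ b k → conv (λ i → a i + a′ i) b k ≡ conv a b k + conv a′ b k
  conv-+ˡ a a′ b zero    = distribʳ _ _ _
  conv-+ˡ a a′ b (suc k) =
    trans (cong₂ _+_ (distribʳ _ _ _) (conv-+ˡ (λ i → a (suc i)) (λ i → a′ (suc i)) b k))
          (+-Props.interchange _ _ _ _)

  conv-+ʳ : ∀ a b b′ k → conv a (λ i → b i + b′ i) k ≡ conv a b k + conv a b′ k
  conv-+ʳ a b b′ zero    = distribˡ _ _ _
  conv-+ʳ a b b′ (suc k) =
    trans (cong₂ _+_ (distribˡ _ _ _) (conv-+ʳ (λ i → a (suc i)) b b′ k)) (+-Props.interchange _ _ _ _)

  conv-*ˡ : ∀ x a b k → conv (λ i → x * a i) b k ≡ x * conv a b k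
  conv-*ˡ x a b zero    = *-assoc _ _ _
  conv-*ˡ x a b (suc k) =
    trans (cong₂ _+_ (*-assoc _ _ _) (conv-*ˡ x (λ i → a (suc i)) b k)) (sym (distribˡ _ _ _))

  private
    conv′ : (ℕ → A) → (ℕ → A) → ℕ → A
    conv′ a b zero    = a 0 * b 0
    conv′ a b (suc k) = a (suc k) * b 0 + conv′ a (λ i → b (suc i)) k

    conv-flip : ∀ a b k → conv b a k ≡ conv′ a b k
    conv-flip a b zero    = *-comm _ _
    conv-flip a b (suc k) = cong₂ _+_ (*-comm _ _) (conv-flip a (λ i → b (suc i)) k)

    conv≡conv′ : ∀ a b k → conv a b k ≡ conv′ a b k
    conv≡conv′ a b zero          = refl
    conv≡conv′ a b (suc zero)    = +-comm _ _
    conv≡conv′ a b (suc (suc k)) = begin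
      x + conv a⁺ b (suc k)             ≡⟨ cong (x +_) (conv≡conv′ a⁺ b (suc k)) ⟩
      x + (y + conv′ a⁺ b⁺ k)           ≡⟨ +-Props.x∙yz≈y∙xz x y _ ⟩
      y + (x + conv′ a⁺ b⁺ k)           ≡⟨ cong (λ z → y + (x + z)) (sym (conv≡conv′ a⁺ b⁺ k)) ⟩
      y + conv a b⁺ (suc k)             ≡⟨ cong (y +_) (conv≡conv′ a b⁺ (suc k)) ⟩
      y + conv′ a b⁺ (suc k)            ∎
      where
      open ≡-Reasoning
      a⁺ b⁺ : ℕ → A
      a⁺ i = a (suc i)
      b⁺ i = b (suc i)
      x y : A
      x = a 0 * b (2 ℕ.+ k)
      y = a (2 ℕ.+ k) * b 0

  conv-comm : ∀ a b k → conv a b k ≡ conv b a k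
  conv-comm a b k = trans (conv≡conv′ a b k) (sym (conv-flip a b k))

  conv-assoc : ∀ a b d k → conv (conv a b) d k ≡ conv a (conv b d) k
  conv-assoc a b d zero    = *-assoc _ _ _
  conv-assoc a b d (suc k) = begin
    (a 0 * b 0) * d (suc k) + conv (λ i → conv a b (suc i)) d k
      ≡⟨ cong ((a 0 * b 0) * d (suc k) +_) tail ⟩
    (a 0 * b 0) * d (suc k) + (a 0 * conv b⁺ d k + conv a⁺ (conv b d) k)
      ≡⟨ sym (+-assoc _ _ _) ⟩
    ((a 0 * b 0) * d (suc k) + a 0 * conv b⁺ d k) + conv a⁺ (conv b d) k
      ≡⟨ cong (_+ conv a⁺ (conv b d) k)
              (trans (cong (_+ a 0 * conv b⁺ d k) (*-assoc _ _ _)) (sym (distribˡ _ _ _))) ⟩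
    a 0 * (b 0 * d (suc k) + conv b⁺ d k) + conv a⁺ (conv b d) k ∎
    where
    open ≡-Reasoning
    a⁺ b⁺ : ℕ → A
    a⁺ i = a (suc i)
    b⁺ i = b (suc i)
    tail : conv (λ i → conv a b (suc i)) d k ≡ a 0 * conv b⁺ d k + conv a⁺ (conv b d) k
    tail = begin
      conv (λ i → a 0 * b⁺ i + conv a⁺ b i) d k
        ≡⟨ conv-+ˡ _ _ d k ⟩
      conv (λ i → a 0 * b⁺ i) d k + conv (conv a⁺ b) d k
        ≡⟨ cong₂ _+_ (conv-*ˡ (a 0) b⁺ d k) (conv-assoc a⁺ b d k) ⟩
      a 0 * conv b⁺ d k + conv a⁺ (conv b d) k ∎

  ZeroAbove : ℕ → (ℕ → A) → Set c
  ZeroAbove r a = ∀ i → r < i → a i ≡ 0#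

  conv-at-degree : ∀ r s {a b} → ZeroAbove r a → ZeroAbove s b → conv a b (r ℕ.+ s) ≡ a r * b s
  conv-at-degree zero    zero    a↑ b↑ = refl
  conv-at-degree zero    (suc s) a↑ b↑ =
    trans (cong (_ +_) (conv-zeroˡ _ (λ i → a↑ (suc i) (s≤s z≤n)) s)) (+-identityʳ _)
  conv-at-degree (suc r) s {a} {b} a↑ b↑ =
    trans (cong₂ _+_ (trans (cong (a 0 *_) (b↑ (suc (r ℕ.+ s)) (s≤s (ℕ.m≤n+m s r)))) (zeroʳ (a 0)))
                     (conv-at-degree r s (λ i r<i → a↑ (suc i) (s≤s r<i)) b↑))
          (+-identityˡ _)

  conv-zeroAbove : ∀ r s {a b} → ZeroAbove r a → ZeroAbove s b → ZeroAbove (r ℕ.+ s) (conv a b)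
  conv-zeroAbove zero    s {a} {b} a↑ b↑ (suc k) (s≤s s<k) =
    trans (cong₂ _+_ (trans (cong (a 0 *_) (b↑ (suc k) (s≤s s<k))) (zeroʳ (a 0)))
                     (conv-zeroˡ b (λ i → a↑ (suc i) (s≤s z≤n)) k))
          (+-identityˡ 0#)
  conv-zeroAbove (suc r) s {a} {b} a↑ b↑ (suc k) (s≤s r+s<k) =
    trans (cong₂ _+_ (trans (cong (a 0 *_) (b↑ (suc k) (s≤s (ℕ.≤-trans (ℕ.m≤n+m s r) (ℕ.<⇒≤ r+s<k)))))
                            (zeroʳ (a 0)))
                     (conv-zeroAbove r s (λ i r<i → a↑ (suc i) (s≤s r<i)) b↑ k r+s<k))
          (+-identityˡ 0#)

  Poly : Set c
  Poly = List A

  coeff : Poly → ℕ → A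
  coeff []      _       = 0#
  coeff (a ∷ p) zero    = a
  coeff (a ∷ p) (suc i) = coeff p i

  record _≈_ (p q : Poly) : Set c where
    constructor mk≈
    field coeff-≡ : ∀ i → coeff p i ≡ coeff q i
  open _≈_ public

  _⊕_ : Poly → Poly → Poly
  []      ⊕ q       = q
  (a ∷ p) ⊕ []      = a ∷ p
  (a ∷ p) ⊕ (b ∷ q) = (a + b) ∷ (p ⊕ q)

  scale : A → Poly → Poly
  scale x = map (x *_)

  _⊗_ : Poly → Poly → Poly
  []      ⊗ q = []
  (a ∷ p) ⊗ q = scale a q ⊕ (0# ∷ (p ⊗ q))

  const : A → Poly
  const a = a ∷ []

  X^_ : ℕ → Poly
  X^ zero  = const 1#
  X^ suc n = 0# ∷ X^ n

  X : Poly
  X = X^ 1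

  _∘_ : Poly → Poly → Poly
  p ∘ g = foldr (λ a acc → const a ⊕ g ⊗ acc) [] p

  IsConstant : Poly → Set c
  IsConstant p = ∀ k → 0 < k → coeff p k ≡ 0#

  coeff-⊕ : ∀ p q i → coeff (p ⊕ q) i ≡ coeff p i + coeff q i
  coeff-⊕ []      q       i       = sym (+-identityˡ _)
  coeff-⊕ (a ∷ p) []      i       = sym (+-identityʳ _)
  coeff-⊕ (a ∷ p) (b ∷ q) zero    = refl
  coeff-⊕ (a ∷ p) (b ∷ q) (suc i) = coeff-⊕ p q i

  coeff-scale : ∀ x p i → coeff (scale x p) i ≡ x * coeff p i
  coeff-scale x []      i       = sym (zeroʳ x)
  coeff-scale x (a ∷ p) zero    = refl
  coeff-scale x (a ∷ p) (suc i) = coeff-scale x p i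

  coeff-⊗ : ∀ p q k → coeff (p ⊗ q) k ≡ conv (coeff p) (coeff q) k
  coeff-⊗ []      q k       = sym (conv-zeroˡ (coeff q) (λ _ → refl) k)
  coeff-⊗ (a ∷ p) q zero    =
    trans (coeff-⊕ (scale a q) (0# ∷ p ⊗ q) 0) (trans (+-identityʳ _) (coeff-scale a q 0))
  coeff-⊗ (a ∷ p) q (suc k) =
    trans (coeff-⊕ (scale a q) (0# ∷ p ⊗ q) (suc k)) (cong₂ _+_ (coeff-scale a q (suc k)) (coeff-⊗ p q k))

  coeff-const-0# : ∀ i → coeff (const 0#) i ≡ 0#
  coeff-const-0# zero    = refl
  coeff-const-0# (suc i) = refl

  coeff-const : ∀ a k → 0 < k → coeff (const a) k ≡ 0#
  coeff-const a (suc k) _ = refl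

  ≈-setoid : Setoid c c
  ≈-setoid = record
    { Carrier       = Poly
    ; _≈_           = _≈_
    ; isEquivalence = record
      { refl  = mk≈ λ _ → refl
      ; sym   = λ e → mk≈ λ i → sym (coeff-≡ e i)
      ; trans = λ e f → mk≈ λ i → trans (coeff-≡ e i) (coeff-≡ f i) } }

  open Setoid ≈-setoid public using () renaming (refl to ≈-refl; sym to ≈-sym; trans to ≈-trans)
  module ≈-Reasoning = SetoidReasoning ≈-setoid

  ∷-cong : ∀ {a b p q} → a ≡ b → p ≈ q → a ∷ p ≈ b ∷ q
  ∷-cong a≡b p≈q = mk≈ λ { zero → a≡b ; (suc i) → coeff-≡ p≈q i }

  ⊕-cong : ∀ {p p′ q q′} → p ≈ p′ → q ≈ q′ → p ⊕ q ≈ p′ ⊕ q′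
  ⊕-cong {p} {p′} {q} {q′} e f = mk≈ λ i →
    trans (coeff-⊕ p q i) (trans (cong₂ _+_ (coeff-≡ e i) (coeff-≡ f i)) (sym (coeff-⊕ p′ q′ i)))

  ⊗-cong : ∀ {p p′ q q′} → p ≈ p′ → q ≈ q′ → p ⊗ q ≈ p′ ⊗ q′
  ⊗-cong {p} {p′} {q} {q′} e f = mk≈ λ i →
    trans (coeff-⊗ p q i) (trans (conv-cong (coeff-≡ e) (coeff-≡ f) i) (sym (coeff-⊗ p′ q′ i)))

  ⊕-congˡ : ∀ p {q q′} → q ≈ q′ → p ⊕ q ≈ p ⊕ q′
  ⊕-congˡ p = ⊕-cong (≈-refl {p})

  ⊗-congˡ : ∀ p {q q′} → q ≈ q′ → p ⊗ q ≈ p ⊗ q′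
  ⊗-congˡ p = ⊗-cong (≈-refl {p})

  ⊕-congʳ : ∀ {p p′} → p ≈ p′ → ∀ q → p ⊕ q ≈ p′ ⊕ q
  ⊕-congʳ p≈p′ q = ⊕-cong p≈p′ (≈-refl {q})

  scale-cong : ∀ x {p p′} → p ≈ p′ → scale x p ≈ scale x p′
  scale-cong x {p} {p′} e = mk≈ λ i →
    trans (coeff-scale x p i) (trans (cong (x *_) (coeff-≡ e i)) (sym (coeff-scale x p′ i)))

  ⊕-identityʳ : ∀ p → p ⊕ [] ≈ p
  ⊕-identityʳ []      = ≈-refl
  ⊕-identityʳ (a ∷ p) = ≈-refl

  ⊕-comm : ∀ p q → p ⊕ q ≈ q ⊕ p
  ⊕-comm p q = mk≈ λ i → trans (coeff-⊕ p q i) (trans (+-comm _ _) (sym (coeff-⊕ q p i)))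

  ⊕-interchange : ∀ p q r s → (p ⊕ q) ⊕ (r ⊕ s) ≈ (p ⊕ r) ⊕ (q ⊕ s)
  ⊕-interchange p q r s = mk≈ λ i → begin
    coeff ((p ⊕ q) ⊕ (r ⊕ s)) i                 ≡⟨ coeff-⊕ (p ⊕ q) (r ⊕ s) i ⟩
    coeff (p ⊕ q) i + coeff (r ⊕ s) i           ≡⟨ cong₂ _+_ (coeff-⊕ p q i) (coeff-⊕ r s i) ⟩
    (coeff p i + coeff q i) + (coeff r i + coeff s i) ≡⟨ +-Props.interchange _ _ _ _ ⟩
    (coeff p i + coeff r i) + (coeff q i + coeff s i) ≡⟨ sym (cong₂ _+_ (coeff-⊕ p r i) (coeff-⊕ q s i)) ⟩
    coeff (p ⊕ r) i + coeff (q ⊕ s) i           ≡⟨ sym (coeff-⊕ (p ⊕ r) (q ⊕ s) i) ⟩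
    coeff ((p ⊕ r) ⊕ (q ⊕ s)) i                 ∎
    where open ≡-Reasoning

  ⊗-comm : ∀ p q → p ⊗ q ≈ q ⊗ p
  ⊗-comm p q = mk≈ λ i → trans (coeff-⊗ p q i) (trans (conv-comm _ _ i) (sym (coeff-⊗ q p i)))

  ⊗-assoc : ∀ p q r → (p ⊗ q) ⊗ r ≈ p ⊗ (q ⊗ r)
  ⊗-assoc p q r = mk≈ λ i → begin
    coeff ((p ⊗ q) ⊗ r) i                        ≡⟨ coeff-⊗ (p ⊗ q) r i ⟩
    conv (coeff (p ⊗ q)) (coeff r) i             ≡⟨ conv-cong (coeff-⊗ p q) (λ _ → refl) i ⟩
    conv (conv (coeff p) (coeff q)) (coeff r) i  ≡⟨ conv-assoc _ _ _ i ⟩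
    conv (coeff p) (conv (coeff q) (coeff r)) i  ≡⟨ sym (conv-cong (λ _ → refl) (coeff-⊗ q r) i) ⟩
    conv (coeff p) (coeff (q ⊗ r)) i             ≡⟨ sym (coeff-⊗ p (q ⊗ r) i) ⟩
    coeff (p ⊗ (q ⊗ r)) i                        ∎
    where open ≡-Reasoning

  ⊗-distribˡ-⊕ : ∀ p q r → p ⊗ (q ⊕ r) ≈ p ⊗ q ⊕ p ⊗ r
  ⊗-distribˡ-⊕ p q r = mk≈ λ i → begin
    coeff (p ⊗ (q ⊕ r)) i                           ≡⟨ coeff-⊗ p (q ⊕ r) i ⟩
    conv (coeff p) (coeff (q ⊕ r)) i                ≡⟨ conv-cong (λ _ → refl) (coeff-⊕ q r) i ⟩
    conv (coeff p) (λ j → coeff q j + coeff r j) i  ≡⟨ conv-+ʳ _ _ _ i ⟩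
    conv (coeff p) (coeff q) i + conv (coeff p) (coeff r) i ≡⟨ sym (cong₂ _+_ (coeff-⊗ p q i) (coeff-⊗ p r i)) ⟩
    coeff (p ⊗ q) i + coeff (p ⊗ r) i               ≡⟨ sym (coeff-⊕ (p ⊗ q) (p ⊗ r) i) ⟩
    coeff (p ⊗ q ⊕ p ⊗ r) i                         ∎
    where open ≡-Reasoning

  ⊗-distribʳ-⊕ : ∀ p q r → (q ⊕ r) ⊗ p ≈ q ⊗ p ⊕ r ⊗ p
  ⊗-distribʳ-⊕ p q r =
    ≈-trans (⊗-comm (q ⊕ r) p) (≈-trans (⊗-distribˡ-⊕ p q r) (⊕-cong (⊗-comm p q) (⊗-comm p r)))

  ⊗-zeroʳ : ∀ p → p ⊗ [] ≈ []
  ⊗-zeroʳ p = ⊗-comm p []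

  scale-⊗ : ∀ x p q → scale x p ⊗ q ≈ scale x (p ⊗ q)
  scale-⊗ x p q = mk≈ λ i → begin
    coeff (scale x p ⊗ q) i                   ≡⟨ coeff-⊗ (scale x p) q i ⟩
    conv (coeff (scale x p)) (coeff q) i      ≡⟨ conv-cong (coeff-scale x p) (λ _ → refl) i ⟩
    conv (λ j → x * coeff p j) (coeff q) i    ≡⟨ conv-*ˡ x _ _ i ⟩
    x * conv (coeff p) (coeff q) i            ≡⟨ cong (x *_) (sym (coeff-⊗ p q i)) ⟩
    x * coeff (p ⊗ q) i                       ≡⟨ sym (coeff-scale x (p ⊗ q) i) ⟩
    coeff (scale x (p ⊗ q)) i                 ∎
    where open ≡-Reasoning

  ⊗-scale : ∀ x p q → p ⊗ scale x q ≈ scale x (p ⊗ q)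
  ⊗-scale x p q = ≈-trans (⊗-comm p (scale x q)) (≈-trans (scale-⊗ x q p) (scale-cong x (⊗-comm q p)))

  scale-⊕ : ∀ x p q → scale x (p ⊕ q) ≈ scale x p ⊕ scale x q
  scale-⊕ x p q = mk≈ λ i → begin
    coeff (scale x (p ⊕ q)) i                      ≡⟨ coeff-scale x (p ⊕ q) i ⟩
    x * coeff (p ⊕ q) i                            ≡⟨ cong (x *_) (coeff-⊕ p q i) ⟩
    x * (coeff p i + coeff q i)                    ≡⟨ distribˡ _ _ _ ⟩
    x * coeff p i + x * coeff q i                  ≡⟨ sym (cong₂ _+_ (coeff-scale x p i) (coeff-scale x q i)) ⟩
    coeff (scale x p) i + coeff (scale x q) i      ≡⟨ sym (coeff-⊕ (scale x p) (scale x q) i) ⟩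
    coeff (scale x p ⊕ scale x q) i                ∎
    where open ≡-Reasoning

  scale-scale : ∀ x y p → scale x (scale y p) ≈ scale (x * y) p
  scale-scale x y p = mk≈ λ i →
    trans (coeff-scale x (scale y p) i) (trans (cong (x *_) (coeff-scale y p i))
          (trans (sym (*-assoc _ _ _)) (sym (coeff-scale (x * y) p i))))

  scale-⊗-scale : ∀ x y p q → scale x p ⊗ scale y q ≈ scale (x * y) (p ⊗ q)
  scale-⊗-scale x y p q = begin
    scale x p ⊗ scale y q       ≈⟨ scale-⊗ x p (scale y q) ⟩
    scale x (p ⊗ scale y q)     ≈⟨ scale-cong x (⊗-scale y p q) ⟩
    scale x (scale y (p ⊗ q))   ≈⟨ scale-scale x y (p ⊗ q) ⟩
    scale (x * y) (p ⊗ q)       ∎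
    where open ≈-Reasoning

  const-⊗ : ∀ a p → const a ⊗ p ≈ scale a p
  const-⊗ a p = mk≈ λ i →
    trans (coeff-⊕ (scale a p) (const 0#) i) (trans (cong (coeff (scale a p) i +_) (coeff-const-0# i)) (+-identityʳ _))

  scale-1# : ∀ p → scale 1# p ≈ p
  scale-1# p = mk≈ λ i → trans (coeff-scale 1# p i) (*-identityˡ _)

  const1-⊗ : ∀ p → const 1# ⊗ p ≈ p
  const1-⊗ p = ≈-trans (const-⊗ 1# p) (scale-1# p)

  0∷-⊗ : ∀ p q → (0# ∷ p) ⊗ q ≈ 0# ∷ (p ⊗ q)
  0∷-⊗ p q = mk≈ λ
    { zero    → trans (coeff-⊕ (scale 0# q) (0# ∷ p ⊗ q) 0)
                      (trans (+-identityʳ _) (trans (coeff-scale 0# q 0) (zeroˡ _)))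
    ; (suc i) → trans (coeff-⊕ (scale 0# q) (0# ∷ p ⊗ q) (suc i))
                      (trans (cong (_+ coeff (p ⊗ q) i) (trans (coeff-scale 0# q (suc i)) (zeroˡ _))) (+-identityˡ _)) }

  X^-⊗ : ∀ m n → X^ m ⊗ X^ n ≈ X^ (m ℕ.+ n)
  X^-⊗ zero    n = const1-⊗ (X^ n)
  X^-⊗ (suc m) n = ≈-trans (0∷-⊗ (X^ m) (X^ n)) (∷-cong refl (X^-⊗ m n))

  coeff-X^-≢ : ∀ m k → k ≢ m → coeff (X^ m) k ≡ 0#
  coeff-X^-≢ zero    zero    k≢m = ⊥-elim (k≢m refl)
  coeff-X^-≢ zero    (suc k) _   = refl
  coeff-X^-≢ (suc m) zero    _   = refl
  coeff-X^-≢ (suc m) (suc k) k≢m = coeff-X^-≢ m k (λ e → k≢m (cong suc e))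

  const⊕X⊗ : ∀ a p → const a ⊕ X ⊗ p ≈ a ∷ p
  const⊕X⊗ a p = ≈-trans (⊕-congˡ (const a) (≈-trans (0∷-⊗ (X^ 0) p) (∷-cong refl (const1-⊗ p))))
                         (∷-cong (+-identityʳ a) ≈-refl)

  ∘-zero : ∀ {p} g → p ≈ [] → p ∘ g ≈ []
  ∘-zero {[]}    g p≈[] = ≈-refl
  ∘-zero {a ∷ p} g p≈[] = mk≈ λ i → begin
    coeff (const a ⊕ g ⊗ (p ∘ g)) i              ≡⟨ coeff-⊕ (const a) (g ⊗ (p ∘ g)) i ⟩
    coeff (const a) i + coeff (g ⊗ (p ∘ g)) i    ≡⟨ cong₂ _+_ (coeff-≡ a≈0 i) (coeff-≡ g⊗tail≈[] i) ⟩
    coeff (const 0#) i + 0#                      ≡⟨ +-identityʳ _ ⟩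
    coeff (const 0#) i                           ≡⟨ coeff-const-0# i ⟩
    0#                                           ∎
    where
    open ≡-Reasoning
    a≈0 : const a ≈ const 0#
    a≈0 = ∷-cong (coeff-≡ p≈[] 0) ≈-refl
    g⊗tail≈[] : g ⊗ (p ∘ g) ≈ []
    g⊗tail≈[] = ≈-trans (⊗-congˡ g (∘-zero {p} g (mk≈ λ i → coeff-≡ p≈[] (suc i)))) (⊗-zeroʳ g)

  ∘-cong : ∀ g {p q} → p ≈ q → p ∘ g ≈ q ∘ g
  ∘-cong g {[]}    {q}     p≈q = ≈-sym (∘-zero g (≈-sym p≈q))
  ∘-cong g {a ∷ p} {[]}    p≈q = ∘-zero g p≈q
  ∘-cong g {a ∷ p} {b ∷ q} p≈q =
    ⊕-cong (∷-cong {q = []} (coeff-≡ p≈q 0) ≈-refl)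
           (⊗-congˡ g (∘-cong g {p} {q} (mk≈ λ i → coeff-≡ p≈q (suc i))))

  ∘-const : ∀ a g → const a ∘ g ≈ const a
  ∘-const a g = ≈-trans (⊕-congˡ (const a) (⊗-zeroʳ g)) (⊕-identityʳ (const a))

  ∘-distribʳ-⊕ : ∀ g p q → (p ⊕ q) ∘ g ≈ p ∘ g ⊕ q ∘ g
  ∘-distribʳ-⊕ g []      q       = ≈-refl
  ∘-distribʳ-⊕ g (a ∷ p) []      = ≈-sym (⊕-identityʳ _)
  ∘-distribʳ-⊕ g (a ∷ p) (b ∷ q) = begin
    const (a + b) ⊕ g ⊗ ((p ⊕ q) ∘ g)                    ≈⟨ ⊕-congˡ (const (a + b))
                                                              (⊗-congˡ g (∘-distribʳ-⊕ g p q)) ⟩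
    const (a + b) ⊕ g ⊗ (p ∘ g ⊕ q ∘ g)                  ≈⟨ ⊕-congˡ (const (a + b)) (⊗-distribˡ-⊕ g _ _) ⟩
    (const a ⊕ const b) ⊕ (g ⊗ (p ∘ g) ⊕ g ⊗ (q ∘ g))
      ≈⟨ ⊕-interchange (const a) (const b) (g ⊗ (p ∘ g)) (g ⊗ (q ∘ g)) ⟩
    (const a ⊕ g ⊗ (p ∘ g)) ⊕ (const b ⊕ g ⊗ (q ∘ g))    ∎
    where open ≈-Reasoning

  ∘-scale : ∀ g x p → scale x p ∘ g ≈ scale x (p ∘ g)
  ∘-scale g x []      = ≈-refl
  ∘-scale g x (a ∷ p) = begin
    const (x * a) ⊕ g ⊗ (scale x p ∘ g)        ≈⟨ ⊕-congˡ (const (x * a)) (⊗-congˡ g (∘-scale g x p)) ⟩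
    const (x * a) ⊕ g ⊗ scale x (p ∘ g)        ≈⟨ ⊕-congˡ (const (x * a)) (⊗-scale x g (p ∘ g)) ⟩
    scale x (const a) ⊕ scale x (g ⊗ (p ∘ g))  ≈⟨ ≈-sym (scale-⊕ x (const a) (g ⊗ (p ∘ g))) ⟩
    scale x (const a ⊕ g ⊗ (p ∘ g))            ∎
    where open ≈-Reasoning

  ∘-0∷ : ∀ g p → (0# ∷ p) ∘ g ≈ g ⊗ (p ∘ g)
  ∘-0∷ g p = mk≈ λ i → trans (coeff-⊕ (const 0#) (g ⊗ (p ∘ g)) i)
                             (trans (cong (_+ coeff (g ⊗ (p ∘ g)) i) (coeff-const-0# i)) (+-identityˡ _))

  ∘-distribʳ-⊗ : ∀ g p q → (p ⊗ q) ∘ g ≈ (p ∘ g) ⊗ (q ∘ g)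
  ∘-distribʳ-⊗ g []      q = ≈-refl
  ∘-distribʳ-⊗ g (a ∷ p) q = begin
    (scale a q ⊕ (0# ∷ p ⊗ q)) ∘ g                    ≈⟨ ∘-distribʳ-⊕ g (scale a q) (0# ∷ p ⊗ q) ⟩
    scale a q ∘ g ⊕ (0# ∷ p ⊗ q) ∘ g                  ≈⟨ ⊕-cong (∘-scale g a q) (∘-0∷ g (p ⊗ q)) ⟩
    scale a (q ∘ g) ⊕ g ⊗ ((p ⊗ q) ∘ g)               ≈⟨ ⊕-cong (≈-sym (const-⊗ a (q ∘ g)))
                                                           (⊗-congˡ g (∘-distribʳ-⊗ g p q)) ⟩
    const a ⊗ (q ∘ g) ⊕ g ⊗ ((p ∘ g) ⊗ (q ∘ g))       ≈⟨ ⊕-congˡ (const a ⊗ (q ∘ g)) (≈-sym (⊗-assoc g _ _)) ⟩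
    const a ⊗ (q ∘ g) ⊕ (g ⊗ (p ∘ g)) ⊗ (q ∘ g)       ≈⟨ ≈-sym (⊗-distribʳ-⊕ (q ∘ g) (const a) (g ⊗ (p ∘ g))) ⟩
    (const a ⊕ g ⊗ (p ∘ g)) ⊗ (q ∘ g)                 ∎
    where open ≈-Reasoning

  ∘-identityʳ : ∀ p → p ∘ X ≈ p
  ∘-identityʳ []      = ≈-refl
  ∘-identityʳ (a ∷ p) = ≈-trans (⊕-congˡ (const a) (⊗-congˡ X (∘-identityʳ p))) (const⊕X⊗ a p)

  X-∘ : ∀ g → X ∘ g ≈ g
  X-∘ g = ≈-trans (∘-0∷ g (const 1#)) (≈-trans (⊗-congˡ g (∘-const 1# g))
                                               (≈-trans (⊗-comm g (const 1#)) (const1-⊗ g)))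

  ∘-inverse : ∀ {g h} → g ∘ h ≈ X → ∀ p → (p ∘ g) ∘ h ≈ p
  ∘-inverse         g∘h≈X []      = ≈-refl
  ∘-inverse {g} {h} g∘h≈X (a ∷ p) = begin
    (const a ⊕ g ⊗ (p ∘ g)) ∘ h                ≈⟨ ∘-distribʳ-⊕ h (const a) (g ⊗ (p ∘ g)) ⟩
    const a ∘ h ⊕ (g ⊗ (p ∘ g)) ∘ h            ≈⟨ ⊕-cong (∘-const a h) (∘-distribʳ-⊗ h g (p ∘ g)) ⟩
    const a ⊕ (g ∘ h) ⊗ ((p ∘ g) ∘ h)          ≈⟨ ⊕-congˡ (const a) (⊗-cong g∘h≈X (∘-inverse {g} {h} g∘h≈X p)) ⟩
    const a ⊕ X ⊗ p                            ≈⟨ const⊕X⊗ a p ⟩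
    a ∷ p                                      ∎
    where open ≈-Reasoning

  isConstant⇒≈const : ∀ {p} → IsConstant p → p ≈ const (coeff p 0)
  isConstant⇒≈const p-const = mk≈ λ { zero → refl ; (suc k) → p-const (suc k) (s≤s z≤n) }

  isConstant-≈ : ∀ {p q} → p ≈ q → IsConstant p → IsConstant q
  isConstant-≈ p≈q p-const k 0<k = trans (sym (coeff-≡ p≈q k)) (p-const k 0<k)

  isConstant-∘ : ∀ {p} g → IsConstant p → IsConstant (p ∘ g)
  isConstant-∘ {p} g p-const =
    isConstant-≈ {q = p ∘ g} (≈-sym (≈-trans (∘-cong g (isConstant⇒≈const {p} p-const)) (∘-const (coeff p 0) g)))
                 (coeff-const (coeff p 0))

  coeff-scale-≈ : ∀ {p q} x → p ≈ scale x q → ∀ k → coeff p k ≡ x * coeff q k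
  coeff-scale-≈ {q = q} x p≈xq k = trans (coeff-≡ p≈xq k) (coeff-scale x q k)

  isConstant-scale : ∀ {G G′} x → G ≈ scale x G′ → IsConstant G′ → IsConstant G
  isConstant-scale x G≈xG′ G′-const k 0<k =
    trans (coeff-scale-≈ x G≈xG′ k) (trans (cong (x *_) (G′-const k 0<k)) (zeroʳ x))

  binomial-square : ∀ M κ → (X^ M ⊕ const κ) ⊗ (X^ M ⊕ const κ) ≈
                            (X^ (M ℕ.+ M) ⊕ scale κ (X^ M)) ⊕ (scale κ (X^ M) ⊕ const (κ * κ))
  binomial-square M κ = begin
    b ⊗ b
      ≈⟨ ⊗-distribʳ-⊕ b (X^ M) (const κ) ⟩
    X^ M ⊗ b ⊕ const κ ⊗ b
      ≈⟨ ⊕-cong (⊗-distribˡ-⊕ (X^ M) (X^ M) (const κ)) (const-⊗ κ b) ⟩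
    (X^ M ⊗ X^ M ⊕ X^ M ⊗ const κ) ⊕ scale κ b
      ≈⟨ ⊕-cong (⊕-cong (X^-⊗ M M) (⊗-comm (X^ M) (const κ))) (scale-⊕ κ (X^ M) (const κ)) ⟩
    (X^ (M ℕ.+ M) ⊕ const κ ⊗ X^ M) ⊕ (scale κ (X^ M) ⊕ const (κ * κ))
      ≈⟨ ⊕-congʳ (⊕-congˡ (X^ (M ℕ.+ M)) (const-⊗ κ (X^ M))) (scale κ (X^ M) ⊕ const (κ * κ)) ⟩
    (X^ (M ℕ.+ M) ⊕ scale κ (X^ M)) ⊕ (scale κ (X^ M) ⊕ const (κ * κ)) ∎
    where
    open ≈-Reasoning
    b : Poly
    b = X^ M ⊕ const κ

open import Data.Integer as ℤ using (ℤ; +_; -[1+_])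
import Data.Integer.Properties as ℤ
open import Data.Integer.Tactic.RingSolver using (solve-∀)

module Parity where

  open import Data.Integer using (_+_; _*_; -_; _-_)
  open import Data.Integer.Divisibility.Signed using (_∣_; divides; ∣m+n∣m⇒∣n; ∣m⇒∣m*n; ∣⇒∣ᵤ)

  Even : ℤ → Set
  Even z = + 2 ∣ z

  Odd : ℤ → Set
  Odd z = ∃ λ k → z ≡ + 2 * k + + 1

  private
    suc-even : ∀ {z} → Even z → Odd (ℤ.suc z)
    suc-even (divides k refl) = k , lemma k
      where
      lemma : ∀ k → + 1 + k * + 2 ≡ + 2 * k + + 1
      lemma = solve-∀

    suc-odd : ∀ {z} → Odd z → Even (ℤ.suc z)
    suc-odd (k , refl) = divides (k + + 1) (lemma k)
      where
      lemma : ∀ k → + 1 + (+ 2 * k + + 1) ≡ (k + + 1) * + 2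
      lemma = solve-∀

    neg-even : ∀ {z} → Even z → Even (- z)
    neg-even (divides k refl) = divides (- k) (lemma k)
      where
      lemma : ∀ k → - (k * + 2) ≡ - k * + 2
      lemma = solve-∀

    neg-odd : ∀ {z} → Odd z → Odd (- z)
    neg-odd (k , refl) = - k - + 1 , lemma k
      where
      lemma : ∀ k → - (+ 2 * k + + 1) ≡ + 2 * (- k - + 1) + + 1
      lemma = solve-∀

    parity-+ : ∀ n → Even (+ n) ⊎ Odd (+ n)
    parity-+ zero    = inj₁ (divides (+ 0) refl)
    parity-+ (suc n) = Sum.swap (Sum.map suc-even suc-odd (parity-+ n))

  parity : ∀ z → Even z ⊎ Odd z
  parity (+ n)    = parity-+ n
  parity -[1+ n ] = Sum.map neg-even neg-odd (parity-+ (suc n))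

  2∣2* : ∀ k → Even (+ 2 * k)
  2∣2* k = divides k (ℤ.*-comm (+ 2) k)

  2∤1 : ¬ Even (+ 1)
  2∤1 2∣1 with ℕ.∣⇒≤ (∣⇒∣ᵤ 2∣1)
  ... | s≤s ()

  even⇒¬odd : ∀ {z} → Even z → ¬ Odd z
  even⇒¬odd 2∣z (k , refl) = 2∤1 (∣m+n∣m⇒∣n 2∣z (2∣2* k))

  odd+even : ∀ {x y} → Odd x → Even y → Odd (x + y)
  odd+even (k , refl) (divides l refl) = k + l , lemma k l
    where
    lemma : ∀ k l → + 2 * k + + 1 + l * + 2 ≡ + 2 * (k + l) + + 1
    lemma = solve-∀

  even+odd : ∀ {x y} → Even x → Odd y → Odd (x + y)
  even+odd {x} {y} x-even y-odd = subst Odd (ℤ.+-comm y x) (odd+even y-odd x-even)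

  odd*odd : ∀ {x y} → Odd x → Odd y → Odd (x * y)
  odd*odd (k , refl) (l , refl) = + 2 * k * l + k + l , lemma k l
    where
    lemma : ∀ k l → (+ 2 * k + + 1) * (+ 2 * l + + 1) ≡ + 2 * (+ 2 * k * l + k + l) + + 1
    lemma = solve-∀

  odd⇒≢0 : ∀ {x} → Odd x → x ≢ + 0
  odd⇒≢0 odd refl = even⇒¬odd (divides (+ 0) refl) odd

  odd*⇒oddˡ : ∀ x {y} → Odd (x * y) → Odd x
  odd*⇒oddˡ x {y} odd with parity x
  ... | inj₂ x-odd  = x-odd
  ... | inj₁ x-even = ⊥-elim (even⇒¬odd (∣m⇒∣m*n y x-even) odd)

  odd*⇒oddʳ : ∀ x {y} → Odd (x * y) → Odd y
  odd*⇒oddʳ x {y} odd = odd*⇒oddˡ y (subst Odd (ℤ.*-comm x y) odd)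

module PowersOfTwo where

  open import Data.Integer using (_*_; _^_; ∣_∣)
  open import Data.Integer.Divisibility.Signed using (_∣_; divides; ∣-trans; ∣⇒∣ᵤ; *-monoʳ-∣; *-cancelˡ-∣)

  open Parity

  2^_ : ℕ → ℤ
  2^ c = (+ 2) ^ c

  2^-≢0 : ∀ c → 2^ c ≢ + 0
  2^-≢0 c 2^c≡0 with ℤ.i^n≡0⇒i≡0 (+ 2) c 2^c≡0
  ... | ()

  2^∣odd*⇒2^∣ : ∀ c {m x} → Odd m → 2^ c ∣ m * x → 2^ c ∣ x
  2^∣odd*⇒2^∣ zero    {x = x} _ _ = divides x (sym (ℤ.*-identityʳ x))
  2^∣odd*⇒2^∣ (suc c) {m} {x} m-odd 2^c+1∣mx with parity x
  ... | inj₂ x-odd            = ⊥-elim (even⇒¬odd (∣-trans (2∣2* (2^ c)) 2^c+1∣mx) (odd*odd m-odd x-odd))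
  ... | inj₁ (divides y refl) = subst (_ ∣_) (ℤ.*-comm (+ 2) y)
    (*-monoʳ-∣ (+ 2) (2^∣odd*⇒2^∣ c m-odd (*-cancelˡ-∣ (+ 2) (subst (_ ∣_) (lemma m y) 2^c+1∣mx))))
    where
    lemma : ∀ m y → m * (y * + 2) ≡ + 2 * (m * y)
    lemma = solve-∀

  private
    n<2^n : ∀ n → n < 2 ℕ.^ n
    n<2^n zero    = s≤s z≤n
    n<2^n (suc n) = ℕ.+-mono-≤ (ℕ.m^n>0 2 n) (ℕ.≤-trans (n<2^n n) (ℕ.m≤m+n (2 ℕ.^ n) 0))

    ∣2^n∣ : ∀ n → ∣ 2^ n ∣ ≡ 2 ℕ.^ n
    ∣2^n∣ zero    = refl
    ∣2^n∣ (suc n) = trans (ℤ.abs-* (+ 2) (2^ n)) (cong (2 ℕ.*_) (∣2^n∣ n))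

  2^∣x∣∤x : ∀ {x} → x ≢ + 0 → ¬ (2^ ∣ x ∣ ∣ x)
  2^∣x∣∤x {x} x≢0 2^∣x∣∣x = ℕ.<⇒≱ (n<2^n ∣ x ∣)
    (subst (ℕ._≤ ∣ x ∣) (∣2^n∣ ∣ x ∣) (ℕ.∣⇒≤ {{∣x∣≢0}} (∣⇒∣ᵤ 2^∣x∣∣x)))
    where
    ∣x∣≢0 : ℕ.NonZero ∣ x ∣
    ∣x∣≢0 = ℕ.≢-nonZero (λ ∣x∣≡0 → x≢0 (ℤ.∣i∣≡0⇒i≡0 ∣x∣≡0))

module ℤ[X] where

  open import Data.Integer using (_+_; _*_; -_; _-_; ∣_∣)
  open import Data.Integer.Divisibility.Signed
    using (_∣_; divides; quotient; ∣m∣n⇒∣m+n; ∣n⇒∣m*n; ∣m⇒∣m*n; *-monoʳ-∣)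

  open Parity
  open PowersOfTwo
  open Polynomial ℤ.+-*-isCommutativeSemiring public hiding (_+_; _*_)

  zero-or-nonzero : ∀ p → (∀ i → coeff p i ≡ + 0) ⊎ ∃ λ i → coeff p i ≢ + 0
  zero-or-nonzero []      = inj₁ λ _ → refl
  zero-or-nonzero (a ∷ p) with a ℤ.≟ + 0 | zero-or-nonzero p
  ... | no a≢0  | _              = inj₂ (0 , a≢0)
  ... | yes a≡0 | inj₁ p≡0       = inj₁ λ { zero → a≡0 ; (suc i) → p≡0 i }
  ... | yes _   | inj₂ (i , pᵢ≢0) = inj₂ (suc i , pᵢ≢0)

  degree : ∀ p {k} → coeff p k ≢ + 0 → Σ ℕ λ r → k ≤ r × coeff p r ≢ + 0 × ZeroAbove r (coeff p)
  degree []      {k}     pₖ≢0 = ⊥-elim (pₖ≢0 refl)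
  degree (a ∷ p) {k}     aₖ≢0 with zero-or-nonzero p
  degree (a ∷ p) {zero}  a≢0  | inj₁ p≡0 = 0 , z≤n , a≢0 , λ { (suc i) _ → p≡0 i }
  degree (a ∷ p) {suc k} pₖ≢0 | inj₁ p≡0 = ⊥-elim (pₖ≢0 (p≡0 k))
  degree (a ∷ p) {zero}  _    | inj₂ (i , pᵢ≢0) with degree p pᵢ≢0
  ... | r , _ , pᵣ≢0 , p↑ = suc r , z≤n , pᵣ≢0 , λ { (suc i) (s≤s r<i) → p↑ i r<i }
  degree (a ∷ p) {suc k} pₖ≢0 | inj₂ _ with degree p pₖ≢0
  ... | r , k≤r , pᵣ≢0 , p↑ = suc r , s≤s k≤r , pᵣ≢0 , λ { (suc i) (s≤s r<i) → p↑ i r<i }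

  isConstant-of-⊗ : ∀ {N} G H → ZeroAbove N (coeff (G ⊗ H)) → coeff H N ≢ + 0 → IsConstant G
  isConstant-of-⊗ {N} G H GH↑ H_N≢0 k 0<k with coeff G k ℤ.≟ + 0
  ... | yes Gₖ≡0 = Gₖ≡0
  ... | no  Gₖ≢0 with degree G Gₖ≢0 | degree H H_N≢0
  ... | r , k≤r , Gᵣ≢0 , G↑ | s , N≤s , Hₛ≢0 , H↑ =
    ⊥-elim ([ Gᵣ≢0 , Hₛ≢0 ]′ (ℤ.i*j≡0⇒i≡0∨j≡0 (coeff G r) Gᵣ*Hₛ≡0))
    where
    Gᵣ*Hₛ≡0 : coeff G r * coeff H s ≡ + 0
    Gᵣ*Hₛ≡0 = begin
      coeff G r * coeff H s         ≡⟨ sym (conv-at-degree r s G↑ H↑) ⟩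
      conv (coeff G) (coeff H) (r ℕ.+ s) ≡⟨ sym (coeff-⊗ G H (r ℕ.+ s)) ⟩
      coeff (G ⊗ H) (r ℕ.+ s)       ≡⟨ GH↑ (r ℕ.+ s) (ℕ.+-mono-≤ (ℕ.≤-trans 0<k k≤r) N≤s) ⟩
      + 0                           ∎
      where open ≡-Reasoning

  record FirstOdd (p : Poly) : Set where
    constructor firstOdd
    field
      index      : ℕ
      odd        : Odd (coeff p index)
      even-below : ∀ k → k < index → Even (coeff p k)

  halve-or-firstOdd : ∀ p → (Σ Poly λ p′ → p ≈ scale (+ 2) p′) ⊎ FirstOdd p
  halve-or-firstOdd []      = inj₁ ([] , ≈-refl)
  halve-or-firstOdd (a ∷ p) with parity a
  ... | inj₂ a-odd             = inj₂ (firstOdd 0 a-odd λ _ ())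
  ... | inj₁ (divides a′ a≡a′2) with halve-or-firstOdd p
  ...   | inj₁ (p′ , p≈2p′) = inj₁ (a′ ∷ p′ , ∷-cong (trans a≡a′2 (ℤ.*-comm a′ (+ 2))) p≈2p′)
  ...   | inj₂ (firstOdd i pᵢ-odd p-even) =
    inj₂ (firstOdd (suc i) pᵢ-odd λ { zero _ → divides a′ a≡a′2 ; (suc k) (s≤s k<i) → p-even k k<i })

  primitivePart₂ : ∀ c G {i} → ¬ (2^ c ∣ coeff G i) →
                   Σ ℕ λ a → Σ Poly λ G′ → G ≈ scale (2^ a) G′ × FirstOdd G′
  primitivePart₂ zero    G {i} 1∤Gᵢ = ⊥-elim (1∤Gᵢ (divides (coeff G i) (sym (ℤ.*-identityʳ _))))
  primitivePart₂ (suc c) G {i} 2^c+1∤Gᵢ with halve-or-firstOdd G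
  ... | inj₂ G-firstOdd = 0 , G , ≈-sym (scale-1# G) , G-firstOdd
  ... | inj₁ (G″ , G≈2G″) with primitivePart₂ c G″ 2^c∤G″ᵢ
    where
    2^c∤G″ᵢ : ¬ (2^ c ∣ coeff G″ i)
    2^c∤G″ᵢ 2^c∣G″ᵢ = 2^c+1∤Gᵢ (subst (2^ suc c ∣_) (sym (coeff-scale-≈ (+ 2) G≈2G″ i)) (*-monoʳ-∣ (+ 2) 2^c∣G″ᵢ))
  ... | a , G′ , G″≈2^aG′ , G′-firstOdd =
    suc a , G′ , ≈-trans G≈2G″ (≈-trans (scale-cong (+ 2) G″≈2^aG′) (scale-scale (+ 2) (2^ a) G′)) ,
    G′-firstOdd

  conv-even : ∀ a b k → (∀ j → j ≤ k → Even (b j)) → Even (conv a b k)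
  conv-even a b zero    b-even = ∣n⇒∣m*n (a 0) (b-even 0 z≤n)
  conv-even a b (suc k) b-even =
    ∣m∣n⇒∣m+n (∣n⇒∣m*n (a 0) (b-even (suc k) ℕ.≤-refl))
              (conv-even (λ i → a (suc i)) b k (λ j j≤k → b-even j (ℕ.m≤n⇒m≤1+n j≤k)))

  conv-odd : ∀ i j a b → (∀ k → k < i → Even (a k)) → Odd (a i) →
                         (∀ k → k < j → Even (b k)) → Odd (b j) → Odd (conv a b (i ℕ.+ j))
  conv-odd zero zero    a b _ aᵢ-odd _ bⱼ-odd = odd*odd aᵢ-odd bⱼ-odd
  conv-odd zero (suc j) a b _ a₀-odd b-even bⱼ-odd =
    odd+even (odd*odd a₀-odd bⱼ-odd) (conv-even (λ i → a (suc i)) b j (λ k k≤j → b-even k (s≤s k≤j)))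
  conv-odd (suc i) j a b a-even aᵢ-odd b-even bⱼ-odd =
    even+odd (∣m⇒∣m*n (b (suc (i ℕ.+ j))) (a-even 0 (s≤s z≤n)))
             (conv-odd i j (λ k → a (suc k)) b (λ k k<i → a-even (suc k) (s≤s k<i)) aᵢ-odd b-even bⱼ-odd)

  NoProperFactorisation : Poly → Set
  NoProperFactorisation F = ∀ G H {m} → m ≢ + 0 → G ⊗ H ≈ scale m F → IsConstant G ⊎ IsConstant H

  record Eisenstein₂ (N : ℕ) (F : Poly) : Set where
    field
      odd-lead   : Odd (coeff F N)
      even-lower : ∀ k → k < N → Even (coeff F k)
      zero-above : ZeroAbove N (coeff F)
      4∤const    : ¬ (+ 4 ∣ coeff F 0)

  cancel-powers-of-two : ∀ {N F G H G′ H′} a b {m} → Odd (coeff F N) →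
    G ≈ scale (2^ a) G′ → H ≈ scale (2^ b) H′ → G ⊗ H ≈ scale m F → ∃ λ q → G′ ⊗ H′ ≈ scale q F
  cancel-powers-of-two {N} {F} {G} {H} {G′} {H′} a b {m} F_N-odd G≈G′ H≈H′ GH≈mF =
    q , mk≈ λ k → ℤ.*-cancelˡ-≡ d (coeff (G′ ⊗ H′) k) _ {{ℤ.≢-nonZero (2^-≢0 (a ℕ.+ b))}} (begin
      d * coeff (G′ ⊗ H′) k    ≡⟨ dX≡mF k ⟩
      m * coeff F k            ≡⟨ cong (_* coeff F k) m≡qd ⟩
      q * d * coeff F k        ≡⟨ lemma q d (coeff F k) ⟩
      d * (q * coeff F k)      ≡⟨ cong (d *_) (sym (coeff-scale q F k)) ⟩
      d * coeff (scale q F) k  ∎)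
    where
    open ≡-Reasoning
    d : ℤ
    d = 2^ (a ℕ.+ b)
    dX≡mF : ∀ k → d * coeff (G′ ⊗ H′) k ≡ m * coeff F k
    dX≡mF k = begin
      d * coeff (G′ ⊗ H′) k                  ≡⟨ cong (_* coeff (G′ ⊗ H′) k) (ℤ.^-distribˡ-+-* (+ 2) a b) ⟩
      2^ a * 2^ b * coeff (G′ ⊗ H′) k
        ≡⟨ sym (coeff-scale-≈ (2^ a * 2^ b) (scale-⊗-scale (2^ a) (2^ b) G′ H′) k) ⟩
      coeff (scale (2^ a) G′ ⊗ scale (2^ b) H′) k ≡⟨ sym (coeff-≡ (⊗-cong G≈G′ H≈H′) k) ⟩
      coeff (G ⊗ H) k                        ≡⟨ coeff-scale-≈ m GH≈mF k ⟩
      m * coeff F k                          ∎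
    d∣m : d ∣ m
    d∣m = 2^∣odd*⇒2^∣ (a ℕ.+ b) F_N-odd
            (divides (coeff (G′ ⊗ H′) N) (trans (ℤ.*-comm (coeff F N) m) (trans (sym (dX≡mF N)) (ℤ.*-comm d _))))
    q : ℤ
    q = quotient d∣m
    m≡qd : m ≡ q * d
    m≡qd = _∣_.equality d∣m
    lemma : ∀ q d f → q * d * f ≡ d * (q * f)
    lemma = solve-∀

  module _ {N F} (eis : Eisenstein₂ N F) where

    open Eisenstein₂ eis

    eisenstein₂-primitive : ∀ {G H} q → FirstOdd G → FirstOdd H → G ⊗ H ≈ scale q F →
                            IsConstant G ⊎ IsConstant H
    eisenstein₂-primitive {G} {H} q (firstOdd i Gᵢ-odd G-even) (firstOdd j Hⱼ-odd H-even) GH≈qF =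
      case i j i+j≡N Gᵢ-odd Hⱼ-odd G-even H-even
      where
      qFᵢ₊ⱼ-odd : Odd (q * coeff F (i ℕ.+ j))
      qFᵢ₊ⱼ-odd = subst Odd (trans (sym (coeff-⊗ G H (i ℕ.+ j))) (coeff-scale-≈ q GH≈qF (i ℕ.+ j)))
                        (conv-odd i j (coeff G) (coeff H) G-even Gᵢ-odd H-even Hⱼ-odd)
      q-odd : Odd q
      q-odd = odd*⇒oddˡ q qFᵢ₊ⱼ-odd
      i+j≡N : i ℕ.+ j ≡ N
      i+j≡N with ℕ.<-cmp (i ℕ.+ j) N
      ... | tri< lt _ _ = ⊥-elim (even⇒¬odd (even-lower _ lt) (odd*⇒oddʳ q qFᵢ₊ⱼ-odd))
      ... | tri≈ _ eq _ = eq
      ... | tri> _ _ gt = ⊥-elim (odd⇒≢0 (odd*⇒oddʳ q qFᵢ₊ⱼ-odd) (zero-above _ gt))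
      GH↑ : ZeroAbove N (coeff (G ⊗ H))
      GH↑ k N<k = trans (coeff-scale-≈ q GH≈qF k) (trans (cong (q *_) (zero-above k N<k)) (ℤ.*-zeroʳ q))
      case : ∀ i j → i ℕ.+ j ≡ N → Odd (coeff G i) → Odd (coeff H j) →
             (∀ k → k < i → Even (coeff G k)) → (∀ k → k < j → Even (coeff H k)) → IsConstant G ⊎ IsConstant H
      case zero    j       refl _ Hⱼ-odd _ _ = inj₁ (isConstant-of-⊗ G H GH↑ (odd⇒≢0 Hⱼ-odd))
      case (suc i) zero    refl Gᵢ-odd _ _ _ =
        inj₂ (isConstant-of-⊗ H G HG↑ (odd⇒≢0 (subst (Odd ∘′ coeff G) (sym (ℕ.+-identityʳ (suc i))) Gᵢ-odd)))
        where
        HG↑ : ZeroAbove (suc i ℕ.+ 0) (coeff (H ⊗ G))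
        HG↑ k lt = trans (coeff-≡ (⊗-comm H G) k) (GH↑ k lt)
      case (suc i) (suc j) _    _ _ G-even H-even with G-even 0 (s≤s z≤n) | H-even 0 (s≤s z≤n)
      ... | divides u G₀≡2u | divides v H₀≡2v =
        ⊥-elim (4∤const (2^∣odd*⇒2^∣ 2 q-odd (divides (u * v) qF₀≡4uv)))
        where
        qF₀≡4uv : q * coeff F 0 ≡ u * v * + 4
        qF₀≡4uv = begin
          q * coeff F 0          ≡⟨ sym (coeff-scale-≈ q GH≈qF 0) ⟩
          coeff (G ⊗ H) 0        ≡⟨ coeff-⊗ G H 0 ⟩
          coeff G 0 * coeff H 0  ≡⟨ cong₂ _*_ G₀≡2u H₀≡2v ⟩
          (u * + 2) * (v * + 2)  ≡⟨ lemma u v ⟩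
          u * v * + 4            ∎
          where
          open ≡-Reasoning
          lemma : ∀ u v → (u * + 2) * (v * + 2) ≡ u * v * + 4
          lemma = solve-∀

    eisenstein₂ : NoProperFactorisation F
    eisenstein₂ G H {m} m≢0 GH≈mF
      with primitivePart₂ ∣ coeff G i ∣ G (2^∣x∣∤x Gᵢ≢0) | primitivePart₂ ∣ coeff H j ∣ H (2^∣x∣∤x Hⱼ≢0)
      where
      nonzero-coeff : ∀ G H → G ⊗ H ≈ scale m F → ∃ λ i → coeff G i ≢ + 0
      nonzero-coeff G H GH≈mF with zero-or-nonzero G
      ... | inj₂ nz  = nz
      ... | inj₁ G≡0 = ⊥-elim ([ m≢0 , odd⇒≢0 odd-lead ]′ (ℤ.i*j≡0⇒i≡0∨j≡0 m (begin
        m * coeff F N             ≡⟨ sym (coeff-scale-≈ m GH≈mF N) ⟩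
        coeff (G ⊗ H) N           ≡⟨ coeff-⊗ G H N ⟩
        conv (coeff G) (coeff H) N ≡⟨ conv-zeroˡ (coeff H) G≡0 N ⟩
        + 0                       ∎)))
        where open ≡-Reasoning
      i = proj₁ (nonzero-coeff G H GH≈mF)
      Gᵢ≢0 = proj₂ (nonzero-coeff G H GH≈mF)
      j = proj₁ (nonzero-coeff H G (≈-trans (⊗-comm H G) GH≈mF))
      Hⱼ≢0 = proj₂ (nonzero-coeff H G (≈-trans (⊗-comm H G) GH≈mF))
    ... | a , G′ , G≈G′ , G′-firstOdd | b , H′ , H≈H′ , H′-firstOdd =
      let q , G′H′≈qF = cancel-powers-of-two a b {m = m} odd-lead G≈G′ H≈H′ GH≈mF in
      Sum.map (isConstant-scale (2^ a) G≈G′) (isConstant-scale (2^ b) H≈H′)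
              (eisenstein₂-primitive q G′-firstOdd H′-firstOdd G′H′≈qF)

  X+_ : ℤ → Poly
  X+ c = c ∷ + 1 ∷ []

  X+-inverse : ∀ c → (X+ c) ∘ (X+ (- c)) ≈ X
  X+-inverse c = mk≈ λ
    { zero → lemma₀ c ; (suc zero) → lemma₁ c ; (suc (suc zero)) → refl ; (suc (suc (suc k))) → refl }
    where
    lemma₀ : ∀ c → c + (- c * (+ 1 + + 0) + + 0) ≡ + 0
    lemma₀ = solve-∀
    lemma₁ : ∀ c → - c * + 0 + (+ 1 * (+ 1 + + 0) + + 0) ≡ + 1
    lemma₁ = solve-∀

  noProperFactorisation-shift : ∀ c F → NoProperFactorisation (F ∘ X+ c) → NoProperFactorisation F
  noProperFactorisation-shift c F F∘s-npf G H {m} m≢0 GH≈mF =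
    Sum.map (unshift G) (unshift H) (F∘s-npf (G ∘ X+ c) (H ∘ X+ c) m≢0 shifted)
    where
    shifted : (G ∘ X+ c) ⊗ (H ∘ X+ c) ≈ scale m (F ∘ X+ c)
    shifted = ≈-trans (≈-sym (∘-distribʳ-⊗ (X+ c) G H)) (≈-trans (∘-cong (X+ c) GH≈mF) (∘-scale (X+ c) m F))
    unshift : ∀ P → IsConstant (P ∘ X+ c) → IsConstant P
    unshift P P∘s-const =
      isConstant-≈ {q = P} (∘-inverse {X+ c} {X+ (- c)} (X+-inverse c) P)
                   (isConstant-∘ {P ∘ X+ c} (X+ (- c)) P∘s-const)

  noProperFactorisation-≈ : ∀ {F F′} → F ≈ F′ → NoProperFactorisation F → NoProperFactorisation F′
  noProperFactorisation-≈ F≈F′ F-npf G H {m} m≢0 GH≈mF′ =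
    F-npf G H m≢0 (≈-trans GH≈mF′ (scale-cong m (≈-sym F≈F′)))

  infix 4 _≡₂_
  record _≡₂_ (p q : Poly) : Set where
    constructor mk≡₂
    field even-diff : ∀ k → Even (coeff p k - coeff q k)
  open _≡₂_ public

  ≈⇒≡₂ : ∀ {p q} → p ≈ q → p ≡₂ q
  ≈⇒≡₂ {p} {q} p≈q = mk≡₂ λ k →
    divides (+ 0) (trans (cong (_- coeff q k) (coeff-≡ p≈q k)) (ℤ.+-inverseʳ (coeff q k)))

  ≡₂-trans : ∀ {p q r} → p ≡₂ q → q ≡₂ r → p ≡₂ r
  ≡₂-trans {p} {q} {r} p≡q q≡r = mk≡₂ λ k →
    subst Even (lemma (coeff p k) (coeff q k) (coeff r k)) (∣m∣n⇒∣m+n (even-diff p≡q k) (even-diff q≡r k))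
    where
    lemma : ∀ x y z → (x - y) + (y - z) ≡ x - z
    lemma = solve-∀

  +-cong-mod2 : ∀ x x′ y y′ → Even (x - x′) → Even (y - y′) → Even ((x + y) - (x′ + y′))
  +-cong-mod2 x x′ y y′ x≡x′ y≡y′ = subst Even (lemma x x′ y y′) (∣m∣n⇒∣m+n x≡x′ y≡y′)
    where
    lemma : ∀ x x′ y y′ → (x - x′) + (y - y′) ≡ (x + y) - (x′ + y′)
    lemma = solve-∀

  *-cong-mod2 : ∀ x x′ y y′ → Even (x - x′) → Even (y - y′) → Even (x * y - x′ * y′)
  *-cong-mod2 x x′ y y′ x≡x′ y≡y′ =
    subst Even (lemma x x′ y y′) (∣m∣n⇒∣m+n (∣n⇒∣m*n x y≡y′) (∣m⇒∣m*n y′ x≡x′))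
    where
    lemma : ∀ x x′ y y′ → x * (y - y′) + (x - x′) * y′ ≡ x * y - x′ * y′
    lemma = solve-∀

  ⊕-cong₂ : ∀ {p p′ q q′} → p ≡₂ p′ → q ≡₂ q′ → p ⊕ q ≡₂ p′ ⊕ q′
  ⊕-cong₂ {p} {p′} {q} {q′} p≡p′ q≡q′ = mk≡₂ λ k →
    subst Even (cong₂ _-_ (sym (coeff-⊕ p q k)) (sym (coeff-⊕ p′ q′ k)))
          (+-cong-mod2 (coeff p k) (coeff p′ k) (coeff q k) (coeff q′ k) (even-diff p≡p′ k) (even-diff q≡q′ k))

  conv-cong₂ : ∀ a a′ b b′ → (∀ i → Even (a i - a′ i)) → (∀ i → Even (b i - b′ i)) →
               ∀ k → Even (conv a b k - conv a′ b′ k)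
  conv-cong₂ a a′ b b′ a≡a′ b≡b′ zero    = *-cong-mod2 (a 0) (a′ 0) (b 0) (b′ 0) (a≡a′ 0) (b≡b′ 0)
  conv-cong₂ a a′ b b′ a≡a′ b≡b′ (suc k) =
    +-cong-mod2 (a 0 * b (suc k)) (a′ 0 * b′ (suc k)) (conv (λ i → a (suc i)) b k) (conv (λ i → a′ (suc i)) b′ k)
                (*-cong-mod2 (a 0) (a′ 0) (b (suc k)) (b′ (suc k)) (a≡a′ 0) (b≡b′ (suc k)))
                (conv-cong₂ (λ i → a (suc i)) (λ i → a′ (suc i)) b b′ (λ i → a≡a′ (suc i)) b≡b′ k)

  ⊗-cong₂ : ∀ {p p′ q q′} → p ≡₂ p′ → q ≡₂ q′ → p ⊗ q ≡₂ p′ ⊗ q′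
  ⊗-cong₂ {p} {p′} {q} {q′} p≡p′ q≡q′ = mk≡₂ λ k →
    subst Even (cong₂ _-_ (sym (coeff-⊗ p q k)) (sym (coeff-⊗ p′ q′ k)))
          (conv-cong₂ (coeff p) (coeff p′) (coeff q) (coeff q′) (even-diff p≡p′) (even-diff q≡q′) k)

module Iterates where

  open import Data.Integer using (_+_; _*_; -_; _-_)
  open import Data.Integer.Divisibility.Signed using (_∣_; divides; ∣m+n∣m⇒∣n; ∣⇒∣ᵤ)

  open Parity
  open ℤ[X]

  binomial-square-mod2 : ∀ M κ c →
    (X^ M ⊕ const κ) ⊗ (X^ M ⊕ const κ) ⊕ const c ≡₂ X^ (M ℕ.+ M) ⊕ const (κ * κ + c)
  binomial-square-mod2 M κ c = ≡₂-trans (≈⇒≡₂ (⊕-congʳ (binomial-square M κ) (const c))) (mk≡₂ expanded)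
    where
    X² κX : Poly
    X² = X^ (M ℕ.+ M)
    κX = scale κ (X^ M)
    coeff-const-+ : ∀ k → coeff (const (κ * κ + c)) k ≡ coeff (const (κ * κ)) k + coeff (const c) k
    coeff-const-+ zero    = refl
    coeff-const-+ (suc k) = refl
    lemma : ∀ x y u v → ((x + y) + (y + u)) + v - (x + (u + v)) ≡ y * + 2
    lemma = solve-∀
    expanded : ∀ k →
      Even (coeff ((X² ⊕ κX) ⊕ (κX ⊕ const (κ * κ)) ⊕ const c) k - coeff (X² ⊕ const (κ * κ + c)) k)
    expanded k = divides (coeff κX k) (begin
      coeff (((X² ⊕ κX) ⊕ (κX ⊕ const (κ * κ))) ⊕ const c) k - coeff (X² ⊕ const (κ * κ + c)) k
        ≡⟨ cong₂ _-_ (trans (coeff-⊕ ((X² ⊕ κX) ⊕ (κX ⊕ const (κ * κ))) (const c) k)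
                            (cong (_+ coeff (const c) k) (trans (coeff-⊕ (X² ⊕ κX) (κX ⊕ const (κ * κ)) k)
                                                (cong₂ _+_ (coeff-⊕ X² κX k) (coeff-⊕ κX (const (κ * κ)) k)))))
                     (trans (coeff-⊕ X² (const (κ * κ + c)) k) (cong (λ w → coeff X² k + w) (coeff-const-+ k))) ⟩
      ((coeff X² k + coeff κX k) + (coeff κX k + coeff (const (κ * κ)) k)) + coeff (const c) k
        - (coeff X² k + (coeff (const (κ * κ)) k + coeff (const c) k))
        ≡⟨ lemma (coeff X² k) (coeff κX k) (coeff (const (κ * κ)) k) (coeff (const c) k) ⟩
      coeff κX k * + 2 ∎)
      where open ≡-Reasoning

  record MonicBinomialMod2 (M : ℕ) (κ : ℤ) (P : Poly) : Set where
    field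
      ≡₂X^M+κ    : P ≡₂ X^ M ⊕ const κ
      coeff-top  : coeff P M ≡ + 1
      zero-above : ZeroAbove M (coeff P)
      coeff-zero : coeff P 0 ≡ κ

  monicBinomialMod2-≈ : ∀ {M κ P Q} → P ≈ Q → MonicBinomialMod2 M κ P → MonicBinomialMod2 M κ Q
  monicBinomialMod2-≈ {M} P≈Q b = record
    { ≡₂X^M+κ    = ≡₂-trans (≈⇒≡₂ (≈-sym P≈Q)) ≡₂X^M+κ
    ; coeff-top  = trans (sym (coeff-≡ P≈Q M)) coeff-top
    ; zero-above = λ k M<k → trans (sym (coeff-≡ P≈Q k)) (zero-above k M<k)
    ; coeff-zero = trans (sym (coeff-≡ P≈Q 0)) coeff-zero }
    where open MonicBinomialMod2 b

  square-minus-two : ∀ {M κ P} → 0 < M → MonicBinomialMod2 M κ P →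
                     MonicBinomialMod2 (M ℕ.+ M) (κ * κ + -[1+ 1 ]) (P ⊗ P ⊕ const -[1+ 1 ])
  square-minus-two {M} {κ} {P} 0<M b = record
    { ≡₂X^M+κ    = ≡₂-trans (⊕-cong₂ (⊗-cong₂ ≡₂X^M+κ ≡₂X^M+κ) (≈⇒≡₂ (≈-refl {const -[1+ 1 ]})))
                            (binomial-square-mod2 M κ -[1+ 1 ])
    ; coeff-top  = trans (coeff-P²-2 (M ℕ.+ M)) (cong₂ _+_ (trans (conv-at-degree M M zero-above zero-above)
                                                                 (cong₂ _*_ coeff-top coeff-top))
                                                          (coeff-const _ (M ℕ.+ M) (ℕ.<-≤-trans 0<M (ℕ.m≤m+n M M))))
    ; zero-above = λ k M+M<k → trans (coeff-P²-2 k) (cong₂ _+_ (conv-zeroAbove M M zero-above zero-above k M+M<k)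
                                                               (coeff-const _ k (ℕ.≤-<-trans z≤n M+M<k)))
    ; coeff-zero = trans (coeff-P²-2 0) (cong (_+ -[1+ 1 ]) (cong₂ _*_ coeff-zero coeff-zero)) }
    where
    open MonicBinomialMod2 b
    coeff-P²-2 : ∀ k → coeff (P ⊗ P ⊕ const -[1+ 1 ]) k ≡ conv (coeff P) (coeff P) k + coeff (const -[1+ 1 ]) k
    coeff-P²-2 k = trans (coeff-⊕ (P ⊗ P) (const -[1+ 1 ]) k) (cong (_+ coeff (const -[1+ 1 ]) k) (coeff-⊗ P P k))

  X+-binomial : ∀ c → MonicBinomialMod2 1 c (X+ c)
  X+-binomial c = record
    { ≡₂X^M+κ    = ≈⇒≡₂ (∷-cong (sym (ℤ.+-identityˡ c)) ≈-refl)
    ; coeff-top  = refl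
    ; zero-above = λ { (suc zero) (s≤s ()) ; (suc (suc k)) _ → refl }
    ; coeff-zero = refl }

  φℤ : Poly
  φℤ = -[1+ 1 ] ∷ + 0 ∷ + 1 ∷ []

  φℤ^∘ : ℕ → Poly
  φℤ^∘ zero    = X
  φℤ^∘ (suc n) = φℤ ∘ φℤ^∘ n

  φℤ-∘ : ∀ g → φℤ ∘ g ≈ g ⊗ g ⊕ const -[1+ 1 ]
  φℤ-∘ g = begin
    const -[1+ 1 ] ⊕ g ⊗ ((+ 0 ∷ + 1 ∷ []) ∘ g)  ≈⟨ ⊕-congˡ (const -[1+ 1 ]) (⊗-congˡ g (X-∘ g)) ⟩
    const -[1+ 1 ] ⊕ g ⊗ g                       ≈⟨ ⊕-comm (const -[1+ 1 ]) (g ⊗ g) ⟩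
    g ⊗ g ⊕ const -[1+ 1 ]                       ∎
    where open ≈-Reasoning

  orbit : ℤ → ℕ → ℤ
  orbit c zero    = c
  orbit c (suc n) = orbit c n * orbit c n + -[1+ 1 ]

  shifted-iterate : ∀ c n → MonicBinomialMod2 (2 ℕ.^ n) (orbit c n) (φℤ^∘ n ∘ X+ c)
  shifted-iterate c zero    = monicBinomialMod2-≈ (≈-sym (X-∘ (X+ c))) (X+-binomial c)
  shifted-iterate c (suc n) =
    subst (λ M → MonicBinomialMod2 M (orbit c (suc n)) (φℤ^∘ (suc n) ∘ X+ c))
          (cong (2 ℕ.^ n ℕ.+_) (sym (ℕ.+-identityʳ _)))
          (monicBinomialMod2-≈ (≈-sym unfold) (square-minus-two (ℕ.m^n>0 2 n) (shifted-iterate c n)))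
    where
    s P : Poly
    s = X+ c
    P = φℤ^∘ n ∘ s
    unfold : (φℤ ∘ φℤ^∘ n) ∘ s ≈ P ⊗ P ⊕ const -[1+ 1 ]
    unfold = begin
      (φℤ ∘ φℤ^∘ n) ∘ s                              ≈⟨ ∘-cong s (φℤ-∘ (φℤ^∘ n)) ⟩
      (φℤ^∘ n ⊗ φℤ^∘ n ⊕ const -[1+ 1 ]) ∘ s          ≈⟨ ∘-distribʳ-⊕ s (φℤ^∘ n ⊗ φℤ^∘ n) (const -[1+ 1 ]) ⟩
      (φℤ^∘ n ⊗ φℤ^∘ n) ∘ s ⊕ const -[1+ 1 ] ∘ s      ≈⟨ ⊕-cong (∘-distribʳ-⊗ s (φℤ^∘ n) (φℤ^∘ n)) (∘-const _ s) ⟩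
      P ⊗ P ⊕ const -[1+ 1 ]                          ∎
      where open ≈-Reasoning

  eisenstein₂-binomial : ∀ {M κ P} t → 0 < M → MonicBinomialMod2 M κ P → (∃ λ u → κ - t ≡ + 4 * u + + 2) →
                         Eisenstein₂ M (P ⊕ const (- t))
  eisenstein₂-binomial {M} {κ} {P} t 0<M b (u , κ-t≡4u+2) = record
    { odd-lead   = + 0 , trans (coeff-F M) (cong₂ _+_ coeff-top (coeff-const (- t) M 0<M))
    ; even-lower = even-lower
    ; zero-above = λ k M<k →
        trans (coeff-F k) (cong₂ _+_ (zero-above k M<k) (coeff-const (- t) k (ℕ.≤-<-trans z≤n M<k)))
    ; 4∤const    = λ 4∣F₀ → 4∤2 (∣m+n∣m⇒∣n (subst (+ 4 ∣_) F₀≡4u+2 4∣F₀) (divides u (ℤ.*-comm (+ 4) u)))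
    }
    where
    open MonicBinomialMod2 b
    coeff-F : ∀ k → coeff (P ⊕ const (- t)) k ≡ coeff P k + coeff (const (- t)) k
    coeff-F k = coeff-⊕ P (const (- t)) k
    F₀≡4u+2 : coeff (P ⊕ const (- t)) 0 ≡ + 4 * u + + 2
    F₀≡4u+2 = trans (coeff-F 0) (trans (cong (_+ - t) coeff-zero) κ-t≡4u+2)
    4∤2 : ¬ (+ 4 ∣ + 2)
    4∤2 4∣2 with ℕ.∣⇒≤ (∣⇒∣ᵤ 4∣2)
    ... | s≤s (s≤s ())
    even-lower : ∀ k → k < M → Even (coeff (P ⊕ const (- t)) k)
    even-lower zero    _   = divides (+ 2 * u + + 1) (trans F₀≡4u+2 (lemma u))
      where
      lemma : ∀ u → + 4 * u + + 2 ≡ (+ 2 * u + + 1) * + 2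
      lemma = solve-∀
    even-lower (suc k) k<M = subst Even (begin
      coeff P (suc k) - coeff (X^ M ⊕ const κ) (suc k)  ≡⟨ cong (λ w → coeff P (suc k) - w) X^M+κ≡0 ⟩
      coeff P (suc k) - + 0                             ≡⟨ ℤ.+-identityʳ _ ⟩
      coeff P (suc k)                                   ≡⟨ sym (ℤ.+-identityʳ _) ⟩
      coeff P (suc k) + coeff (const (- t)) (suc k)     ≡⟨ sym (coeff-F (suc k)) ⟩
      coeff (P ⊕ const (- t)) (suc k)                   ∎) (even-diff ≡₂X^M+κ (suc k))
      where
      open ≡-Reasoning
      X^M+κ≡0 : coeff (X^ M ⊕ const κ) (suc k) ≡ + 0
      X^M+κ≡0 = trans (coeff-⊕ (X^ M) (const κ) (suc k)) (trans (ℤ.+-identityʳ _) (coeff-X^-≢ M (suc k) (ℕ.<⇒≢ k<M)))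

  orbit0-≡2-mod4 : ∀ n → ∃ λ u → orbit (+ 0) (suc n) ≡ + 4 * u + + 2
  orbit0-≡2-mod4 zero    = -[1+ 0 ] , refl
  orbit0-≡2-mod4 (suc n) with orbit0-≡2-mod4 n
  ... | u , orbit≡4u+2 = + 4 * u * u + + 4 * u , trans (cong (λ z → z * z + -[1+ 1 ]) orbit≡4u+2) (lemma u)
    where
    lemma : ∀ u → (+ 4 * u + + 2) * (+ 4 * u + + 2) + -[1+ 1 ] ≡ + 4 * (+ 4 * u * u + + 4 * u) + + 2
    lemma = solve-∀

  orbit1≡-1 : ∀ n → orbit (+ 1) (suc n) ≡ -[1+ 0 ]
  orbit1≡-1 zero    = refl
  orbit1≡-1 (suc n) = cong (λ z → z * z + -[1+ 1 ]) (orbit1≡-1 n)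

  orbit-minus-≡2-mod4 : ∀ n t → (+ 4 ∣ t) ⊎ (+ 4 ∣ t - + 1) →
                        ∃ λ c → ∃ λ u → orbit c (suc n) - t ≡ + 4 * u + + 2
  orbit-minus-≡2-mod4 n t (inj₁ (divides s refl)) with orbit0-≡2-mod4 n
  ... | u , orbit≡4u+2 = + 0 , u - s , trans (cong (_- s * + 4) orbit≡4u+2) (lemma u s)
    where
    lemma : ∀ u s → + 4 * u + + 2 - s * + 4 ≡ + 4 * (u - s) + + 2
    lemma = solve-∀
  orbit-minus-≡2-mod4 n t (inj₂ (divides s t-1≡4s)) =
    + 1 , - s - + 1 , trans (cong₂ _-_ (orbit1≡-1 n) (trans (lemma₁ t) (cong (_+ + 1) t-1≡4s))) (lemma₂ s)
    where
    lemma₁ : ∀ t → t ≡ t - + 1 + + 1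
    lemma₁ = solve-∀
    lemma₂ : ∀ s → -[1+ 0 ] - (s * + 4 + + 1) ≡ + 4 * (- s - + 1) + + 2
    lemma₂ = solve-∀

  iterate-minus : ℕ → ℤ → Poly
  iterate-minus n t = φℤ^∘ n ⊕ const (- t)

  iterate-minus-noProperFactorisation : ∀ c n t → (∃ λ u → orbit c (suc n) - t ≡ + 4 * u + + 2) →
                                        NoProperFactorisation (iterate-minus (suc n) t)
  iterate-minus-noProperFactorisation c n t orbit-t≡2 =
    noProperFactorisation-shift c F (noProperFactorisation-≈ (≈-sym F∘s≈) (eisenstein₂
      (eisenstein₂-binomial t (ℕ.m^n>0 2 (suc n)) (shifted-iterate c (suc n)) orbit-t≡2)))
    where
    F : Poly
    F = iterate-minus (suc n) t
    F∘s≈ : F ∘ X+ c ≈ φℤ^∘ (suc n) ∘ X+ c ⊕ const (- t)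
    F∘s≈ = ≈-trans (∘-distribʳ-⊕ (X+ c) (φℤ^∘ (suc n)) (const (- t)))
                   (⊕-congˡ (φℤ^∘ (suc n) ∘ X+ c) (∘-const (- t) (X+ c)))

  iterate-coeff-top : ∀ n → coeff (φℤ^∘ n) (2 ℕ.^ n) ≡ + 1
  iterate-coeff-top n =
    trans (sym (coeff-≡ (∘-identityʳ (φℤ^∘ n)) (2 ℕ.^ n))) (MonicBinomialMod2.coeff-top (shifted-iterate (+ 0) n))

  iterate-minus-coeff-top : ∀ n t → coeff (iterate-minus (suc n) t) (2 ℕ.^ suc n) ≢ + 0
  iterate-minus-coeff-top n t top≡0 = case trans (sym top≡1) top≡0 of λ ()
    where
    top≡1 : coeff (iterate-minus (suc n) t) (2 ℕ.^ suc n) ≡ + 1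
    top≡1 = trans (coeff-⊕ (φℤ^∘ (suc n)) (const (- t)) (2 ℕ.^ suc n))
                  (cong₂ _+_ (iterate-coeff-top (suc n)) (coeff-const (- t) (2 ℕ.^ suc n) (ℕ.m^n>0 2 (suc n))))

open import Defs
open import Data.Nat.Coprimality using (1-coprimeTo) renaming (sym to coprime-sym)
open import Data.Rational as ℚ using (ℚ; mkℚ; 0ℚ; 1ℚ; ↥_; ↧ₙ_; toℚᵘ)
import Data.Rational.Properties as ℚ
import Data.Rational.Unnormalised as ℚᵘ
import Data.Rational.Unnormalised.Properties as ℚᵘ

module IntegerEmbedding where

  open import Data.Integer using (∣_∣)

  ι : ℤ → ℚ
  ι = ℤ→ℚ

  ι-mkℚ : ∀ a → ι a ≡ mkℚ a 0 (coprime-sym (1-coprimeTo ∣ a ∣))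
  ι-mkℚ (+ n)    = ℚ.normalize-coprime (coprime-sym (1-coprimeTo n))
  ι-mkℚ -[1+ n ] = cong ℚ.-_ (ℚ.normalize-coprime (coprime-sym (1-coprimeTo (suc n))))

  ι-injective : ∀ {a b} → ι a ≡ ι b → a ≡ b
  ι-injective {a} {b} ιa≡ιb = cong ↥_ (trans (sym (ι-mkℚ a)) (trans ιa≡ιb (ι-mkℚ b)))

  ι-+ : ∀ a b → ι (a ℤ.+ b) ≡ ι a ℚ.+ ι b
  ι-+ a b rewrite ι-mkℚ a | ι-mkℚ b = cong (ℚ._/ 1) (sym (cong₂ ℤ._+_ (ℤ.*-identityʳ a) (ℤ.*-identityʳ b)))

  ι-* : ∀ a b → ι (a ℤ.* b) ≡ ι a ℚ.* ι b
  ι-* a b rewrite ι-mkℚ a | ι-mkℚ b = refl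

  ι-neg : ∀ a → ι (ℤ.- a) ≡ ℚ.- ι a
  ι-neg (+ zero)   = refl
  ι-neg (+ suc n)  = refl
  ι-neg -[1+ n ] rewrite ι-mkℚ (+ suc n) = refl

  ι-numerator : ∀ a → ι (↥ a) ≡ ι (+ ↧ₙ a) ℚ.* a
  ι-numerator a@(mkℚ n d _) = ℚ.toℚᵘ-injective (begin
    toℚᵘ (ι n)
      ≈⟨ ℚᵘ.≃-reflexive (cong toℚᵘ (ι-mkℚ n)) ⟩
    ℚᵘ.mkℚᵘ n 0
      ≈⟨ ℚᵘ.*≡* (trans (cong (n ℤ.*_) (cong +_ (ℕ.*-identityˡ (suc d)))) (lemma n (+ suc d))) ⟩
    ℚᵘ.mkℚᵘ (+ suc d) 0 ℚᵘ.* ℚᵘ.mkℚᵘ n d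
      ≈⟨ ℚᵘ.≃-sym (ℚᵘ.≃-reflexive (cong (λ z → toℚᵘ z ℚᵘ.* toℚᵘ a) (ι-mkℚ (+ suc d)))) ⟩
    toℚᵘ (ι (+ suc d)) ℚᵘ.* toℚᵘ a
      ≈⟨ ℚᵘ.≃-sym (ℚ.toℚᵘ-homo-* (ι (+ suc d)) a) ⟩
    toℚᵘ (ι (+ suc d) ℚ.* a)              ∎)
    where
    open ℚᵘ.≃-Reasoning
    lemma : ∀ n x → n ℤ.* x ≡ (x ℤ.* n) ℤ.* + 1
    lemma = solve-∀

  ι-cancelˡ : ∀ D x → ι (+ suc D) ℚ.* x ≡ 0ℚ → x ≡ 0ℚ
  ι-cancelˡ D x dx≡0 rewrite ι-mkℚ (+ suc D) = begin
    x                  ≡⟨ sym (ℚ.*-identityˡ x) ⟩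
    1ℚ ℚ.* x           ≡⟨ cong (ℚ._* x) (sym (ℚ.*-inverseˡ d)) ⟩
    ℚ.1/ d ℚ.* d ℚ.* x ≡⟨ ℚ.*-assoc (ℚ.1/ d) d x ⟩
    ℚ.1/ d ℚ.* (d ℚ.* x) ≡⟨ cong (ℚ.1/ d ℚ.*_) dx≡0 ⟩
    ℚ.1/ d ℚ.* 0ℚ      ≡⟨ ℚ.*-zeroʳ (ℚ.1/ d) ⟩
    0ℚ                 ∎
    where
    open ≡-Reasoning
    d : ℚ
    d = mkℚ (+ suc D) 0 (coprime-sym (1-coprimeTo (suc D)))

open IntegerEmbedding

module ℚ[X] = Polynomial (IsCommutativeRing.isCommutativeSemiring ℚ.+-*-isCommutativeRing)

coeff≡ : ∀ p k → coeff p k ≡ ℚ[X].coeff p k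
coeff≡ []      k       = refl
coeff≡ (a ∷ p) zero    = refl
coeff≡ (a ∷ p) (suc k) = coeff≡ p k

≈ₚ⇒≈ : ∀ {p q} → p ≈ₚ q → p ℚ[X].≈ q
≈ₚ⇒≈ {p} {q} p≈q = ℚ[X].mk≈ λ k → trans (sym (coeff≡ p k)) (trans (p≈q k) (coeff≡ q k))

≈⇒≈ₚ : ∀ {p q} → p ℚ[X].≈ q → p ≈ₚ q
≈⇒≈ₚ {p} {q} p≈q k = trans (coeff≡ p k) (trans (ℚ[X].coeff-≡ p≈q k) (sym (coeff≡ q k)))

+ₚ≡⊕ : ∀ p q → p +ₚ q ≡ p ℚ[X].⊕ q
+ₚ≡⊕ []      q       = refl
+ₚ≡⊕ (a ∷ p) []      = refl
+ₚ≡⊕ (a ∷ p) (b ∷ q) = cong (_ ∷_) (+ₚ≡⊕ p q)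

*ₚ≡⊗ : ∀ p q → p *ₚ q ≡ p ℚ[X].⊗ q
*ₚ≡⊗ []      q = refl
*ₚ≡⊗ (a ∷ p) q = trans (+ₚ≡⊕ (scale a q) (0ℚ ∷ p *ₚ q)) (cong (λ r → scale a q ℚ[X].⊕ (0ℚ ∷ r)) (*ₚ≡⊗ p q))

ι[X] : ℤ[X].Poly → Poly
ι[X] = map ι

coeff-ι[X] : ∀ p k → coeff (ι[X] p) k ≡ ι (ℤ[X].coeff p k)
coeff-ι[X] []      k       = refl
coeff-ι[X] (a ∷ p) zero    = refl
coeff-ι[X] (a ∷ p) (suc k) = coeff-ι[X] p k

ι[X]-⊕ : ∀ p q → ι[X] (p ℤ[X].⊕ q) ≡ ι[X] p +ₚ ι[X] q
ι[X]-⊕ []      q       = refl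
ι[X]-⊕ (a ∷ p) []      = refl
ι[X]-⊕ (a ∷ p) (b ∷ q) = cong₂ _∷_ (ι-+ a b) (ι[X]-⊕ p q)

ι[X]-scale : ∀ c p → ι[X] (ℤ[X].scale c p) ≡ scale (ι c) (ι[X] p)
ι[X]-scale c []      = refl
ι[X]-scale c (a ∷ p) = cong₂ _∷_ (ι-* c a) (ι[X]-scale c p)

ι[X]-⊗ : ∀ p q → ι[X] (p ℤ[X].⊗ q) ≡ ι[X] p *ₚ ι[X] q
ι[X]-⊗ []      q = refl
ι[X]-⊗ (a ∷ p) q = trans (ι[X]-⊕ (ℤ[X].scale a q) (+ 0 ∷ p ℤ[X].⊗ q))
                         (cong₂ _+ₚ_ (ι[X]-scale a q) (cong (0ℚ ∷_) (ι[X]-⊗ p q)))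

ι[X]-∘ : ∀ p g → ι[X] (p ℤ[X].∘ g) ≡ ι[X] p ∘ₚ ι[X] g
ι[X]-∘ []      g = refl
ι[X]-∘ (a ∷ p) g = trans (ι[X]-⊕ (ℤ[X].const a) (g ℤ[X].⊗ (p ℤ[X].∘ g)))
                         (cong (const (ι a) +ₚ_) (trans (ι[X]-⊗ g (p ℤ[X].∘ g)) (cong (ι[X] g *ₚ_) (ι[X]-∘ p g))))

ι[X]-φℤ^∘ : ∀ n → ι[X] (Iterates.φℤ^∘ n) ≡ φ^∘ n
ι[X]-φℤ^∘ zero    = refl
ι[X]-φℤ^∘ (suc n) = trans (ι[X]-∘ Iterates.φℤ (Iterates.φℤ^∘ n)) (cong (φ ∘ₚ_) (ι[X]-φℤ^∘ n))

clearDenominators : ∀ g → Σ ℕ λ D → Σ ℤ[X].Poly λ G → ι[X] G ℚ[X].≈ ℚ[X].scale (ι (+ suc D)) g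
clearDenominators []                  = 0 , [] , ℚ[X].≈-refl
clearDenominators (a@(mkℚ n d _) ∷ g) with clearDenominators g
... | D , G , G≈Dg = D ℕ.+ d ℕ.* suc D , n ℤ.* + suc D ∷ ℤ[X].scale (+ suc d) G , ℚ[X].∷-cong head tail
  where
  open CommutativeSemigroupProperties (CommutativeMonoid.commutativeSemigroup ℚ.*-1-commutativeMonoid) using (xy∙z≈xz∙y)
  d·D : ι (+ suc d) ℚ.* ι (+ suc D) ≡ ι (+ suc (D ℕ.+ d ℕ.* suc D))
  d·D = sym (trans (cong ι (ℤ.pos-* (suc d) (suc D))) (ι-* (+ suc d) (+ suc D)))
  head : ι (n ℤ.* + suc D) ≡ ι (+ suc (D ℕ.+ d ℕ.* suc D)) ℚ.* a
  head = begin
    ι (n ℤ.* + suc D)                     ≡⟨ ι-* n (+ suc D) ⟩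
    ι n ℚ.* ι (+ suc D)                   ≡⟨ cong (ℚ._* ι (+ suc D)) (ι-numerator a) ⟩
    ι (+ suc d) ℚ.* a ℚ.* ι (+ suc D)     ≡⟨ xy∙z≈xz∙y (ι (+ suc d)) a (ι (+ suc D)) ⟩
    ι (+ suc d) ℚ.* ι (+ suc D) ℚ.* a     ≡⟨ cong (ℚ._* a) d·D ⟩
    ι (+ suc (D ℕ.+ d ℕ.* suc D)) ℚ.* a   ∎
    where open ≡-Reasoning
  tail : ι[X] (ℤ[X].scale (+ suc d) G) ℚ[X].≈ ℚ[X].scale (ι (+ suc (D ℕ.+ d ℕ.* suc D))) g
  tail = begin
    ι[X] (ℤ[X].scale (+ suc d) G)                          ≡⟨ ι[X]-scale (+ suc d) G ⟩
    ℚ[X].scale (ι (+ suc d)) (ι[X] G)                       ≈⟨ ℚ[X].scale-cong (ι (+ suc d)) G≈Dg ⟩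
    ℚ[X].scale (ι (+ suc d)) (ℚ[X].scale (ι (+ suc D)) g)   ≈⟨ ℚ[X].scale-scale (ι (+ suc d)) (ι (+ suc D)) g ⟩
    ℚ[X].scale (ι (+ suc d) ℚ.* ι (+ suc D)) g              ≡⟨ cong (λ x → ℚ[X].scale x g) d·D ⟩
    ℚ[X].scale (ι (+ suc (D ℕ.+ d ℕ.* suc D))) g            ∎
    where open ℚ[X].≈-Reasoning

ι[X]-injective : ∀ {p q} → ι[X] p ℚ[X].≈ ι[X] q → p ℤ[X].≈ q
ι[X]-injective {p} {q} p≈q = ℤ[X].mk≈ λ k →
  ι-injective (trans (sym (coeff-ι[X] p k)) (trans (coeff≡ (ι[X] p) k) (trans (ℚ[X].coeff-≡ p≈q k)
              (trans (sym (coeff≡ (ι[X] q) k)) (coeff-ι[X] q k)))))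

coeff-*ₚ : ∀ g h k → coeff (g *ₚ h) k ≡ ℚ[X].conv (ℚ[X].coeff g) (ℚ[X].coeff h) k
coeff-*ₚ g h k = trans (coeff≡ (g *ₚ h) k) (trans (cong (λ p → ℚ[X].coeff p k) (*ₚ≡⊗ g h)) (ℚ[X].coeff-⊗ g h k))

module _ (F : ℤ[X].Poly) {N} (0<N : 0 < N) (F_N≢0 : ℤ[X].coeff F N ≢ + 0) where

  private
    f : Poly
    f = ι[X] F

    f_N≢0 : coeff f N ≢ 0ℚ
    f_N≢0 f_N≡0 = F_N≢0 (ι-injective (trans (sym (coeff-ι[X] F N)) f_N≡0))

    constant⇒unit : ∀ g h → f ≈ₚ g *ₚ h → ∀ D G → ι[X] G ℚ[X].≈ ℚ[X].scale (ι (+ suc D)) g →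
                    ℤ[X].IsConstant G → IsUnit g
    constant⇒unit g h f≈gh D G G≈Dg G-const = ℚ[X].coeff g 0 , g₀≢0 , ≈⇒≈ₚ (ℚ[X].isConstant⇒≈const {g} g-const)
      where
      g-const : ℚ[X].IsConstant g
      g-const k 0<k = ι-cancelˡ D (ℚ[X].coeff g k) (begin
        ι (+ suc D) ℚ.* ℚ[X].coeff g k            ≡⟨ sym (ℚ[X].coeff-scale (ι (+ suc D)) g k) ⟩
        ℚ[X].coeff (ℚ[X].scale (ι (+ suc D)) g) k ≡⟨ sym (ℚ[X].coeff-≡ G≈Dg k) ⟩
        ℚ[X].coeff (ι[X] G) k                     ≡⟨ sym (coeff≡ (ι[X] G) k) ⟩
        coeff (ι[X] G) k                          ≡⟨ coeff-ι[X] G k ⟩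
        ι (ℤ[X].coeff G k)                        ≡⟨ cong ι (G-const k 0<k) ⟩
        0ℚ                                        ∎)
        where open ≡-Reasoning
      g₀≢0 : ℚ[X].coeff g 0 ≢ 0ℚ
      g₀≢0 g₀≡0 = f_N≢0 (trans (f≈gh N) (trans (coeff-*ₚ g h N) (ℚ[X].conv-zeroˡ (ℚ[X].coeff h) g≡0 N)))
        where
        g≡0 : ∀ k → ℚ[X].coeff g k ≡ 0ℚ
        g≡0 zero    = g₀≡0
        g≡0 (suc k) = g-const (suc k) (s≤s z≤n)

    integral-factors : ∀ g h → f ≈ₚ g *ₚ h → ∀ D E G H →
      ι[X] G ℚ[X].≈ ℚ[X].scale (ι (+ suc D)) g → ι[X] H ℚ[X].≈ ℚ[X].scale (ι (+ suc E)) h →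
      G ℤ[X].⊗ H ℤ[X].≈ ℤ[X].scale (+ suc D ℤ.* + suc E) F
    integral-factors g h f≈gh D E G H G≈Dg H≈Eh = ι[X]-injective (begin
      ι[X] (G ℤ[X].⊗ H)                                     ≡⟨ trans (ι[X]-⊗ G H) (*ₚ≡⊗ (ι[X] G) (ι[X] H)) ⟩
      ι[X] G ℚ[X].⊗ ι[X] H                                  ≈⟨ ℚ[X].⊗-cong G≈Dg H≈Eh ⟩
      ℚ[X].scale d g ℚ[X].⊗ ℚ[X].scale e h                  ≈⟨ ℚ[X].scale-⊗-scale d e g h ⟩
      ℚ[X].scale (d ℚ.* e) (g ℚ[X].⊗ h)                     ≈⟨ ℚ[X].scale-cong (d ℚ.* e) gh≈f ⟩
      ℚ[X].scale (d ℚ.* e) f                                ≡⟨ cong (λ x → ℚ[X].scale x f) (sym (ι-* (+ suc D) (+ suc E))) ⟩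
      ℚ[X].scale (ι (+ suc D ℤ.* + suc E)) f                ≡⟨ sym (ι[X]-scale (+ suc D ℤ.* + suc E) F) ⟩
      ι[X] (ℤ[X].scale (+ suc D ℤ.* + suc E) F)             ∎)
      where
      open ℚ[X].≈-Reasoning
      d e : ℚ
      d = ι (+ suc D)
      e = ι (+ suc E)
      gh≈f : g ℚ[X].⊗ h ℚ[X].≈ f
      gh≈f = ℚ[X].≈-sym (≈ₚ⇒≈ (subst (f ≈ₚ_) (*ₚ≡⊗ g h) f≈gh))

  irreducible-ι[X] : ℤ[X].NoProperFactorisation F → Irreducible (ι[X] F)
  irreducible-ι[X] F-npf = nonzero , non-unit , factor
    where
    nonzero : ¬ (f ≈ₚ [])
    nonzero f≈[] = f_N≢0 (f≈[] N)
    non-unit : ¬ IsUnit f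
    non-unit (c , _ , f≈c) = f_N≢0 (trans (f≈c N) (trans (coeff≡ (const c) N) (ℚ[X].coeff-const c N 0<N)))
    factor : ∀ g h → f ≈ₚ g *ₚ h → IsUnit g ⊎ IsUnit h
    factor g h f≈gh with clearDenominators g | clearDenominators h
    ... | D , G , G≈Dg | E , H , H≈Eh =
      Sum.map (constant⇒unit g h f≈gh D G G≈Dg) (constant⇒unit h g f≈hg E H H≈Eh)
              (F-npf G H {+ suc D ℤ.* + suc E} (λ ()) (integral-factors g h f≈gh D E G H G≈Dg H≈Eh))
      where
      f≈hg : f ≈ₚ h *ₚ g
      f≈hg k = trans (f≈gh k) (trans (coeff-*ₚ g h k) (trans (ℚ[X].conv-comm _ _ k) (sym (coeff-*ₚ h g k))))

ι[X]-iterate-minus : ∀ n t → ι[X] (Iterates.iterate-minus n t) ≡ φ^∘ n +ₚ const (ℚ.- ℤ→ℚ t)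
ι[X]-iterate-minus n t =
  trans (ι[X]-⊕ (Iterates.φℤ^∘ n) (ℤ[X].const (ℤ.- t))) (cong₂ _+ₚ_ (ι[X]-φℤ^∘ n) (cong (_∷ []) (ι-neg t)))

open import Data.Nat using (_≥_)
open import Data.Integer using (_-_)
open import Data.Integer.Divisibility using (_∣_)
open import Data.Integer.Divisibility.Signed using (∣ᵤ⇒∣)
open import Data.Rational using (-_)

lemma6p1 : (t₀ : ℤ) → (+ 4 ∣ t₀ ⊎ + 4 ∣ (t₀ - + 1)) →
    (n : ℕ) → n ≥ 1 → Irreducible (φ^∘ n +ₚ const (- ℤ→ℚ t₀))
lemma6p1 t₀ t₀≡0∨1 (suc n) _ with Iterates.orbit-minus-≡2-mod4 n t₀ (Sum.map ∣ᵤ⇒∣ ∣ᵤ⇒∣ t₀≡0∨1)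
... | c , orbit-t₀≡2 =
  subst Irreducible (ι[X]-iterate-minus (suc n) t₀)
        (irreducible-ι[X] (Iterates.iterate-minus (suc n) t₀) (ℕ.m^n>0 2 (suc n)) (Iterates.iterate-minus-coeff-top n t₀)
                          (Iterates.iterate-minus-noProperFactorisation c n t₀ orbit-t₀≡2))
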